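{- For $n\ge1$ let $S_n(132)$ be the set of $132$-avoiding permutations of $\{1,\dots,n\}$. Let $a_0=1$, and for $n\ge1$ let $a_n$ be the number of $\sigma=\sigma_1\cdots\sigma_n\in S_n(132)$ such that every index $i\in\{1,\dots,n\}$ satisfies $|\sigma_i-\sigma_{i+1}|=1$ or $|\sigma_{i-1}-\sigma_i|=1$ (ignoring nonexistent entries), and let $b_n$ be the number of such $\sigma$ that additionally satisfy $\sigma_1=n$. Let $A(t)=\sum_{n\ge0}a_nt^n$ and $B(t)=\sum_{n\ge1}b_nt^n$. Then $$A(t)=\frac{1-t+2t^3-\sqrt{1-2t-3t^2+4t^3-4t^4}}{2t^2},\qquad B(t)=\frac{1+t-2t^2+2t^3-\sqrt{1-2t-3t^2+4t^3-4t^4}}{2(1-t+t^2)}.$$ In particular, $(a_n)_{n\ge0}$ begins $1,1,2,2,6,10,26,54,134,306,754,\dots$ and $(b_n)_{n\ge0}$ (with $b_0=0$) begins $0,1,1,1,2,3,7,14,33,73,174,\dots$.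
   Context: A permutation $\sigma\in S_n$ avoids $132$ if there are no indices $i<j<k$ with $\sigma_i<\sigma_k<\sigma_j$. The square root is the branch with constant term $1$ as a formal power series in $t$. -}

module Defs where

open import Data.Bool using (Bool; true; false; _∧_; _∨_; not)
open import Data.Nat using (ℕ; zero; suc; _<ᵇ_; _≡ᵇ_)
open import Data.List using (List; []; _∷_; map; concatMap; upTo; filterᵇ; length; foldr)
open import Data.Bool.ListAction using (any)
open import Data.Integer using (ℤ; +_; -_; _*_; _-_; _+_)
open import Relation.Binary.PropositionalEquality using (_≡_)

oneTo : ℕ → List ℕ
oneTo m = map suc (upTo m)

words : ℕ → ℕ → List (List ℕ)
words zero    m = [] ∷ []
words (suc k) m = concatMap (λ w → map (λ x → x ∷ w) (oneTo m)) (words k m)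

noDup : List ℕ → Bool
noDup []       = true
noDup (x ∷ xs) = not (any (λ y → x ≡ᵇ y) xs) ∧ noDup xs

perms : ℕ → List (List ℕ)
perms n = filterᵇ noDup (words n n)

-- Pattern 132: indices i<j<k with σ_i < σ_k < σ_j.

has32after : ℕ → List ℕ → Bool
has32after x []       = false
has32after x (y ∷ ys) = any (λ z → (x <ᵇ z) ∧ (z <ᵇ y)) ys ∨ has32after x ys

contains132 : List ℕ → Bool
contains132 []       = false
contains132 (x ∷ xs) = has32after x xs ∨ contains132 xs

avoids132 : List ℕ → Bool
avoids132 σ = not (contains132 σ)

-- Adjacency condition: every index i has |σ_i − σ_{i+1}| = 1 or
-- |σ_{i−1} − σ_i| = 1 (nonexistent entries ignored; a word of length ≤ 1
-- satisfies it vacuously, matching a₁ = 1).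

adj : ℕ → ℕ → Bool
adj x y = (x ≡ᵇ suc y) ∨ (y ≡ᵇ suc x)

-- prevOK : whether the current entry is already adjacent (by value) to its
-- left neighbour.
goodFrom : Bool → List ℕ → Bool
goodFrom prevOK []            = true
goodFrom prevOK (x ∷ [])      = prevOK
goodFrom prevOK (x ∷ y ∷ rest) = (prevOK ∨ adj x y) ∧ goodFrom (adj x y) (y ∷ rest)

good : List ℕ → Bool
good []           = true
good (x ∷ [])     = true
good (x ∷ y ∷ rs) = goodFrom false (x ∷ y ∷ rs)

headIs : ℕ → List ℕ → Bool
headIs n []      = false
headIs n (x ∷ _) = x ≡ᵇ n

a : ℕ → ℕ
a zero    = 1
a (suc n) = length (filterᵇ (λ σ → avoids132 σ ∧ good σ) (perms (suc n)))

b : ℕ → ℕ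
b zero    = 0
b (suc n) = length (filterᵇ (λ σ → avoids132 σ ∧ good σ ∧ headIs (suc n) σ) (perms (suc n)))

FPS : Set
FPS = ℕ → ℤ

infix 4 _≈_
_≈_ : FPS → FPS → Set
f ≈ g = ∀ n → f n ≡ g n

infixl 6 _⊕_ _⊖_
infixl 7 _⊛_

_⊕_ : FPS → FPS → FPS
(f ⊕ g) n = f n + g n

_⊖_ : FPS → FPS → FPS
(f ⊖ g) n = f n - g n

sumℤ : List ℤ → ℤ
sumℤ = foldr _+_ (+ 0)

_⊛_ : FPS → FPS → FPS
(f ⊛ g) n = sumℤ (map (λ k → f k * g (n Data.Nat.∸ k)) (upTo (suc n)))

poly : List ℤ → FPS
poly []       n       = + 0
poly (c ∷ cs) zero    = c
poly (c ∷ cs) (suc n) = poly cs n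

gf : (ℕ → ℕ) → FPS
gf s n = + (s n)

IsSqrt : FPS → FPS → Set
IsSqrt S D = (S zero ≡ + 1) Data.Product.× (S ⊛ S ≈ D)
  where import Data.Product

Disc : FPS
Disc = poly (+ 1 ∷ - + 2 ∷ - + 3 ∷ + 4 ∷ - + 4 ∷ [])

module Submission where

-- Deleting the maximum n = m + 1 splits a 132-avoider uniquely as α' n β, where α' lies entirely above β
-- and α' (standardised) and β are again 132-avoiders, so the avoiders can be listed recursively.  For the
-- adjacency condition only n interacts with the splitting: its one possible neighbour value is m, which is
-- the last entry of α' or, when α' is empty, the first entry of β.  Counting avoiders whose maximum is
-- first (H) or last (L), with a ⁺ when that end entry is already satisfied from outside, yields
-- convolution recurrences for the number G of good avoiders; L⁺ = H⁺ because both obey the same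
-- recurrence.  In generating functions, G = 1 + x H⁺ (1 + G) and H⁺ = x H⁺ + x G − x² H⁺, while A = G + x
-- and B = x + x H⁺. Eliminating G and H⁺, each claimed square root squares to the discriminant modulo
-- these two equations.

module Counting where

  open import Data.Bool using (Bool; true; false; _∧_; not)
  open import Data.Nat using (ℕ; suc; _+_; _*_; _∸_; _≤_; _<_; z≤n; s≤s)
  open import Data.Nat.Properties
  open import Data.Nat.ListAction using (sum)
  open import Data.Nat.ListAction.Properties using (sum-++)
  open import Data.List using (List; []; _∷_; _++_; _∷ʳ_; map; concatMap; length; filterᵇ; applyUpTo; upTo)
  open import Data.List.Properties using (length-++; map-++; map-∘; map-cong-local; length-applyUpTo; applyUpTo-∷ʳ)
  open import Data.List.Membership.Propositional using (_∈_; find)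
  open import Data.List.Membership.Propositional.Properties
    using (∈-∃++; ∈-concatMap⁻; ∈-applyUpTo⁺; ∈-applyUpTo⁻; ∈-upTo⁻)
  open import Data.List.Relation.Unary.Any using (here; there)
  open import Data.List.Relation.Unary.All as All using (All; []; _∷_)
  open import Data.List.Relation.Unary.Unique.Propositional using (Unique)
  open import Data.List.Relation.Unary.AllPairs using ([]; _∷_)
  import Data.List.Relation.Unary.Unique.Propositional.Properties as Unique
  open import Data.Product using (_×_; _,_)
  open import Data.Empty using (⊥; ⊥-elim)
  open import Function using (_∘_; id)
  open import Relation.Binary.PropositionalEquality

  private variable
    A B : Set

  𝟙 : Bool → ℕ
  𝟙 true  = 1
  𝟙 false = 0

  count : (A → Bool) → List A → ℕ
  count p = sum ∘ map (𝟙 ∘ p)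

  length-filterᵇ : ∀ (p : A → Bool) xs → length (filterᵇ p xs) ≡ count p xs
  length-filterᵇ p [] = refl
  length-filterᵇ p (x ∷ xs) with p x
  ... | true  = cong suc (length-filterᵇ p xs)
  ... | false = length-filterᵇ p xs

  count-++ : ∀ (p : A → Bool) xs ys → count p (xs ++ ys) ≡ count p xs + count p ys
  count-++ p xs ys = trans (cong sum (map-++ (𝟙 ∘ p) xs ys)) (sum-++ (map (𝟙 ∘ p) xs) _)

  count-concatMap : ∀ (p : B → Bool) (f : A → List B) xs →
                    count p (concatMap f xs) ≡ sum (map (count p ∘ f) xs)
  count-concatMap p f []       = refl
  count-concatMap p f (x ∷ xs) =
    trans (count-++ p (f x) (concatMap f xs)) (cong (count p (f x) +_) (count-concatMap p f xs))

  count-map : ∀ (p : B → Bool) (g : A → B) xs → count p (map g xs) ≡ count (p ∘ g) xs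
  count-map p g xs = cong sum (sym (map-∘ xs))

  count-cong-local : ∀ {p q : A → Bool} {xs} → All (λ x → p x ≡ q x) xs → count p xs ≡ count q xs
  count-cong-local p≡q = cong sum (map-cong-local (All.map (cong 𝟙) p≡q))

  sum-map-cong-local : ∀ {f g : A → ℕ} {xs} → All (λ x → f x ≡ g x) xs → sum (map f xs) ≡ sum (map g xs)
  sum-map-cong-local f≡g = cong sum (map-cong-local f≡g)

  sum-map-zero : ∀ {f : A → ℕ} {xs} → All (λ x → f x ≡ 0) xs → sum (map f xs) ≡ 0
  sum-map-zero []            = refl
  sum-map-zero (fx≡0 ∷ f≡0) = cong₂ _+_ fx≡0 (sum-map-zero f≡0)

  count-false : ∀ {p : A → Bool} {xs} → All (λ x → p x ≡ false) xs → count p xs ≡ 0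
  count-false p≡false = sum-map-zero (All.map (cong 𝟙) p≡false)

  sum-map-*ʳ : ∀ (f : A → ℕ) c xs → sum (map (λ x → f x * c) xs) ≡ sum (map f xs) * c
  sum-map-*ʳ f c []       = refl
  sum-map-*ʳ f c (x ∷ xs) =
    trans (cong (f x * c +_) (sum-map-*ʳ f c xs)) (sym (*-distribʳ-+ c (f x) (sum (map f xs))))

  count-∧ˡ : ∀ b (q : A → Bool) xs → count (λ y → b ∧ q y) xs ≡ 𝟙 b * count q xs
  count-∧ˡ true  q xs = sym (+-identityʳ (count q xs))
  count-∧ˡ false q xs = count-false {xs = xs} (All.tabulate (λ _ → refl))

  count-pairs : ∀ {C : Set} (P : A → Bool) (Q : B → Bool) (R : C → Bool) (g : A → B → C) xs ys →
                All (λ x → All (λ y → R (g x y) ≡ P x ∧ Q y) ys) xs →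
                sum (map (λ x → count R (map (g x) ys)) xs) ≡ count P xs * count Q ys
  count-pairs P Q R g xs ys R≡P∧Q = begin
      sum (map (λ x → count R (map (g x) ys)) xs)
    ≡⟨ sum-map-cong-local (All.map count-row R≡P∧Q) ⟩
      sum (map (λ x → 𝟙 (P x) * count Q ys) xs)
    ≡⟨ sum-map-*ʳ (𝟙 ∘ P) (count Q ys) xs ⟩
      count P xs * count Q ys
    ∎
    where
    open ≡-Reasoning
    count-row : ∀ {x} → All (λ y → R (g x y) ≡ P x ∧ Q y) ys → count R (map (g x) ys) ≡ 𝟙 (P x) * count Q ys
    count-row {x} row = trans (count-map R (g x) ys) (trans (count-cong-local row) (count-∧ˡ (P x) Q ys))

  count-split : ∀ (h p : A → Bool) xs → count p xs ≡ count (λ x → h x ∧ p x) xs + count (λ x → not (h x) ∧ p x) xs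
  count-split h p [] = refl
  count-split h p (x ∷ xs) with h x | p x
  ... | true  | true  = cong suc (count-split h p xs)
  ... | true  | false = count-split h p xs
  ... | false | true  = trans (cong suc (count-split h p xs)) (sym (+-suc _ _))
  ... | false | false = count-split h p xs

  ∈-++-remove : ∀ {x y : A} xs ys → y ∈ xs ++ x ∷ ys → y ≢ x → y ∈ xs ++ ys
  ∈-++-remove []       ys (here refl) y≢x = ⊥-elim (y≢x refl)
  ∈-++-remove []       ys (there y∈)  y≢x = y∈
  ∈-++-remove (z ∷ xs) ys (here refl) y≢x = here refl
  ∈-++-remove (z ∷ xs) ys (there y∈)  y≢x = there (∈-++-remove xs ys y∈ y≢x)

  unique-⊆⇒length≤ : ∀ {xs ys : List A} → Unique xs → (∀ {x} → x ∈ xs → x ∈ ys) → length xs ≤ length ys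
  unique-⊆⇒length≤ {xs = []}     _          _  = z≤n
  unique-⊆⇒length≤ {xs = x ∷ xs} (x∉xs ∷ u) xs⊆ys with ∈-∃++ (xs⊆ys (here refl))
  ... | ys₁ , ys₂ , refl = subst (suc (length xs) ≤_) (sym length-removed)
                                (s≤s (unique-⊆⇒length≤ u (λ y∈ → ∈-++-remove ys₁ ys₂ (xs⊆ys (there y∈)) (≢x y∈))))
    where
    ≢x : ∀ {y} → y ∈ xs → y ≢ x
    ≢x y∈ y≡x = All.lookup x∉xs y∈ (sym y≡x)
    length-removed : length (ys₁ ++ x ∷ ys₂) ≡ suc (length (ys₁ ++ ys₂))
    length-removed = trans (length-++ ys₁) (trans (+-suc (length ys₁) (length ys₂)) (cong suc (sym (length-++ ys₁))))

  -- Compare with the list lo+1, …, hi.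
  unique-interval⇒length≤ : ∀ lo hi {xs : List ℕ} → Unique xs → All (λ x → lo < x × x ≤ hi) xs →
                            length xs ≤ hi ∸ lo
  unique-interval⇒length≤ lo hi {xs} u bounds =
    subst (length xs ≤_) (length-applyUpTo _ (hi ∸ lo)) (unique-⊆⇒length≤ u ∈interval)
    where
    ∈interval : ∀ {x} → x ∈ xs → x ∈ applyUpTo (λ i → suc (lo + i)) (hi ∸ lo)
    ∈interval {x} x∈ with All.lookup bounds x∈
    ... | lo<x , x≤hi = subst (_∈ applyUpTo _ (hi ∸ lo)) (m+[n∸m]≡n lo<x)
          (∈-applyUpTo⁺ (λ i → suc (lo + i)) (m+n≤o⇒m≤o∸n (suc (x ∸ suc lo))
            (subst (_≤ hi) (trans (sym (m+[n∸m]≡n lo<x)) (cong suc (+-comm lo _))) x≤hi)))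

  unique-concatMap : ∀ (f : A → List B) (decode : B → A) {xs} → Unique xs → All (Unique ∘ f) xs →
                     All (λ x → All (λ y → decode y ≡ x) (f x)) xs → Unique (concatMap f xs)
  unique-concatMap f decode {[]}     _          _          _                 = []
  unique-concatMap f decode {x ∷ xs} (x∉xs ∷ u) (ux ∷ uxs) (decx ∷ decxs) =
    Unique.++⁺ ux (unique-concatMap f decode u uxs decxs) disjoint
    where
    disjoint : ∀ {y} → y ∈ f x × y ∈ concatMap f xs → ⊥
    disjoint (y∈fx , y∈rest) with find (∈-concatMap⁻ f {xs = xs} y∈rest)
    ... | z , z∈xs , y∈fz =
      All.lookup x∉xs z∈xs (trans (sym (All.lookup decx y∈fx)) (All.lookup (All.lookup decxs z∈xs) y∈fz))

  sum-upTo-first : ∀ (f : ℕ → ℕ) m → (∀ i → i < m → f (suc i) ≡ 0) → sum (map f (upTo (suc m))) ≡ f 0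
  sum-upTo-first f m rest≡0 =
    trans (cong (f 0 +_) (sum-map-zero (All.tabulate λ i∈ → let i , i<m , i≡ = ∈-applyUpTo⁻ suc i∈ in
                                                             trans (cong f i≡) (rest≡0 i i<m))))
          (+-identityʳ (f 0))

  sum-upTo-last : ∀ (f : ℕ → ℕ) m → (∀ j → j < m → f j ≡ 0) → sum (map f (upTo (suc m))) ≡ f m
  sum-upTo-last f m init≡0 = begin
      sum (map f (upTo (suc m)))
    ≡⟨ cong (sum ∘ map f) (sym (applyUpTo-∷ʳ id m)) ⟩
      sum (map f (upTo m ∷ʳ m))
    ≡⟨ cong sum (map-++ f (upTo m) (m ∷ [])) ⟩
      sum (map f (upTo m) ++ f m ∷ [])
    ≡⟨ sum-++ (map f (upTo m)) (f m ∷ []) ⟩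
      sum (map f (upTo m)) + (f m + 0)
    ≡⟨ cong₂ _+_ (sum-map-zero (All.tabulate (init≡0 _ ∘ ∈-upTo⁻))) (+-identityʳ (f m)) ⟩
      f m
    ∎
    where open ≡-Reasoning


module Permutations where

  open import Defs
  open Counting
  open import Data.Bool using (Bool; true; false; _∧_; T; T?)
  open import Data.Bool.ListAction using (any)
  open import Data.Nat using (ℕ; zero; suc; _≤_; z≤n; s≤s; _≡ᵇ_)
  open import Data.Nat.Properties using (suc-injective)
  open import Data.List using (List; []; _∷_; map; length)
  open import Data.List.Properties using (∷-injectiveˡ)
  open import Data.List.Membership.Propositional using (_∈_; find; lose)
  open import Data.List.Membership.Propositional.Properties
    using (∈-map⁻; ∈-map⁺; ∈-upTo⁻; ∈-upTo⁺; ∈-concatMap⁻; ∈-concatMap⁺; ∈-filter⁻; ∈-filter⁺)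
  open import Data.List.Relation.Unary.Any using (here)
  open import Data.List.Relation.Unary.All as All using (All; []; _∷_)
  open import Data.List.Relation.Unary.AllPairs using ([]; _∷_)
  open import Data.List.Relation.Unary.Unique.Propositional using (Unique)
  import Data.List.Relation.Unary.Unique.Propositional.Properties as Unique
  open import Data.Product using (_×_; _,_)
  open import Function using (_∘_)
  open import Function.Bundles using (Equivalence)
  open import Data.Bool.Properties using (T-∧; T-not-≡)
  open import Relation.Nullary using (contradiction)
  open import Relation.Binary.PropositionalEquality

  ≡ᵇ-refl : ∀ n → (n ≡ᵇ n) ≡ true
  ≡ᵇ-refl zero    = refl
  ≡ᵇ-refl (suc n) = ≡ᵇ-refl n

  ≢⇒≡ᵇ-false : ∀ {m n} → m ≢ n → (m ≡ᵇ n) ≡ false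
  ≢⇒≡ᵇ-false {zero}  {zero}  m≢n = contradiction refl m≢n
  ≢⇒≡ᵇ-false {zero}  {suc n} _   = refl
  ≢⇒≡ᵇ-false {suc m} {zero}  _   = refl
  ≢⇒≡ᵇ-false {suc m} {suc n} m≢n = ≢⇒≡ᵇ-false (m≢n ∘ cong suc)

  any-false : ∀ {p : ℕ → Bool} {xs} → All (λ x → p x ≡ false) xs → any p xs ≡ false
  any-false []          = refl
  any-false (px≡f ∷ ps) rewrite px≡f = any-false ps

  any-false⁻ : ∀ (p : ℕ → Bool) xs → any p xs ≡ false → All (λ x → p x ≡ false) xs
  any-false⁻ p []       _  = []
  any-false⁻ p (x ∷ xs) eq with p x in px
  ... | false = px ∷ any-false⁻ p xs eq

  InRange : ℕ → ℕ → Set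
  InRange m x = 1 ≤ x × x ≤ m

  record IsPerm (n : ℕ) (σ : List ℕ) : Set where
    field
      length≡ : length σ ≡ n
      inRange : All (InRange n) σ
      unique  : Unique σ

  ∈-oneTo⁻ : ∀ {x m} → x ∈ oneTo m → InRange m x
  ∈-oneTo⁻ x∈ with ∈-map⁻ suc x∈
  ... | y , y∈ , refl = s≤s z≤n , ∈-upTo⁻ y∈

  ∈-oneTo⁺ : ∀ {x m} → InRange m x → x ∈ oneTo m
  ∈-oneTo⁺ {suc y} (_ , y<m) = ∈-map⁺ suc (∈-upTo⁺ y<m)

  ∈-words⁻ : ∀ {k m σ} → σ ∈ words k m → length σ ≡ k × All (InRange m) σ
  ∈-words⁻ {zero}      (here refl) = refl , []
  ∈-words⁻ {suc k} {m} σ∈ with find (∈-concatMap⁻ (λ w → map (_∷ w) (oneTo m)) {xs = words k m} σ∈)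
  ... | w , w∈ , σ∈′ with ∈-map⁻ (_∷ w) σ∈′
  ... | x , x∈ , refl with ∈-words⁻ {k} w∈
  ... | length≡ , inRange = cong suc length≡ , ∈-oneTo⁻ x∈ ∷ inRange

  ∈-words⁺ : ∀ {k m σ} → length σ ≡ k → All (InRange m) σ → σ ∈ words k m
  ∈-words⁺ {zero}  {σ = []}    _       _                = here refl
  ∈-words⁺ {suc k} {m} {x ∷ σ} length≡ (x∈ ∷ inRange) =
    ∈-concatMap⁺ (λ w → map (_∷ w) (oneTo m)) {xs = words k m}
      (lose (∈-words⁺ (suc-injective length≡) inRange) (∈-map⁺ (_∷ σ) (∈-oneTo⁺ x∈)))

  noDup⇒unique : ∀ σ → T (noDup σ) → Unique σ
  noDup⇒unique []      _ = []
  noDup⇒unique (x ∷ σ) t with Equivalence.to T-∧ t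
  ... | fresh , rest =
    All.map ≡ᵇ-false⇒≢ (any-false⁻ (x ≡ᵇ_) σ (Equivalence.to T-not-≡ fresh)) ∷ noDup⇒unique σ rest
    where
    ≡ᵇ-false⇒≢ : ∀ {y} → (x ≡ᵇ y) ≡ false → x ≢ y
    ≡ᵇ-false⇒≢ x≡ᵇx≡false refl with trans (sym (≡ᵇ-refl x)) x≡ᵇx≡false
    ... | ()

  unique⇒noDup : ∀ σ → Unique σ → T (noDup σ)
  unique⇒noDup []      _          = _
  unique⇒noDup (x ∷ σ) (x∉σ ∷ u) = Equivalence.from T-∧
    (Equivalence.from T-not-≡ (any-false (All.map ≢⇒≡ᵇ-false x∉σ)) , unique⇒noDup σ u)

  ∈-perms⁻ : ∀ {k σ} → σ ∈ perms k → IsPerm k σ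
  ∈-perms⁻ {k} {σ} σ∈ with ∈-filter⁻ (T? ∘ noDup) {xs = words k k} σ∈
  ... | σ∈words , t with ∈-words⁻ σ∈words
  ... | length≡ , inRange = record { length≡ = length≡ ; inRange = inRange ; unique = noDup⇒unique σ t }

  ∈-perms⁺ : ∀ {k σ} → IsPerm k σ → σ ∈ perms k
  ∈-perms⁺ {k} {σ} perm = ∈-filter⁺ (T? ∘ noDup) {xs = words k k}
    (∈-words⁺ (IsPerm.length≡ perm) (IsPerm.inRange perm)) (unique⇒noDup σ (IsPerm.unique perm))

  unique-words : ∀ k m → Unique (words k m)
  unique-words zero    m = [] ∷ []
  unique-words (suc k) m = unique-concatMap (λ w → map (_∷ w) (oneTo m)) tail (unique-words k m)
    (All.tabulate (λ _ → Unique.map⁺ ∷-injectiveˡ unique-oneTo))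
    (All.tabulate (λ {w} _ → All.tabulate (λ y∈ → tail-∷ w y∈)))
    where
    tail : List ℕ → List ℕ
    tail []      = []
    tail (_ ∷ w) = w
    unique-oneTo : Unique (oneTo m)
    unique-oneTo = Unique.map⁺ suc-injective (Unique.upTo⁺ m)
    tail-∷ : ∀ w {y} → y ∈ map (_∷ w) (oneTo m) → tail y ≡ w
    tail-∷ w y∈ with ∈-map⁻ (_∷ w) y∈
    ... | _ , _ , refl = refl

  unique-perms : ∀ k → Unique (perms k)
  unique-perms k = Unique.filter⁺ (T? ∘ noDup) (unique-words k k)

  false-∧ : ∀ {b} c → b ≡ false → b ∧ c ≡ false
  false-∧ c refl = refl

  true-∧ : ∀ {b} c → b ≡ true → b ∧ c ≡ c
  true-∧ c refl = refl


module Pattern132 where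

  open import Defs
  open Permutations
  open import Data.Bool using (Bool; true; false; _∧_; _∨_)
  open import Data.Bool.Properties using (∨-identityʳ; ∧-zeroʳ)
  open import Data.Bool.ListAction using (any; or)
  open import Data.Nat using (ℕ; zero; suc; _+_; _≤_; _<_; s≤s; _<ᵇ_)
  open import Data.Nat.Properties using (<⇒≤)
  open import Data.List using (List; []; _∷_; _++_; map)
  open import Data.List.Properties using (map-∘; map-cong)
  open import Function using (_∘_)
  open import Data.List.Membership.Propositional using (_∈_)
  open import Data.List.Relation.Unary.Any using (here; there)
  open import Data.List.Relation.Unary.All as All using (All; []; _∷_)
  open import Data.Empty using (⊥)
  open import Relation.Binary.PropositionalEquality

  Avoids132 : List ℕ → Set
  Avoids132 σ = contains132 σ ≡ false

  shift : ℕ → List ℕ → List ℕ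
  shift c = map (c +_)

  ∨-false⁻ˡ : ∀ {a b} → a ∨ b ≡ false → a ≡ false
  ∨-false⁻ˡ {false} _ = refl

  ∨-false⁻ʳ : ∀ {a b} → a ∨ b ≡ false → b ≡ false
  ∨-false⁻ʳ {false} b≡false = b≡false

  <⇒<ᵇ-true : ∀ {m n} → m < n → (m <ᵇ n) ≡ true
  <⇒<ᵇ-true {zero}  {suc n} _         = refl
  <⇒<ᵇ-true {suc m} {suc n} (s≤s m<n) = <⇒<ᵇ-true m<n

  ≤⇒<ᵇ-false : ∀ {m n} → n ≤ m → (m <ᵇ n) ≡ false
  ≤⇒<ᵇ-false {m}     {zero}  _         = refl
  ≤⇒<ᵇ-false {suc m} {suc n} (s≤s n≤m) = ≤⇒<ᵇ-false n≤m

  <ᵇ-+-cancelˡ : ∀ c m n → ((c + m) <ᵇ (c + n)) ≡ (m <ᵇ n)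
  <ᵇ-+-cancelˡ zero    m n = refl
  <ᵇ-+-cancelˡ (suc c) m n = <ᵇ-+-cancelˡ c m n

  any-++ : ∀ (p : ℕ → Bool) xs ys → any p (xs ++ ys) ≡ any p xs ∨ any p ys
  any-++ p []       ys = refl
  any-++ p (x ∷ xs) ys with p x
  ... | true  = refl
  ... | false = any-++ p xs ys

  any-map : ∀ (p : ℕ → Bool) (g : ℕ → ℕ) xs → any p (map g xs) ≡ any (p ∘ g) xs
  any-map p g xs = cong or (sym (map-∘ xs))

  any-cong : ∀ {p q : ℕ → Bool} → (∀ x → p x ≡ q x) → ∀ xs → any p xs ≡ any q xs
  any-cong p≡q xs = cong or (map-cong p≡q xs)

  ≤⇒<ᵇ∧-false : ∀ {m n} b → n ≤ m → ((m <ᵇ n) ∧ b) ≡ false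
  ≤⇒<ᵇ∧-false b n≤m rewrite ≤⇒<ᵇ-false n≤m = refl

  has32after-shift : ∀ c x ys → has32after (c + x) (shift c ys) ≡ has32after x ys
  has32after-shift c x []       = refl
  has32after-shift c x (y ∷ ys) = cong₂ _∨_
    (trans (any-map (λ z → ((c + x) <ᵇ z) ∧ (z <ᵇ (c + y))) (c +_) ys) (any-cong (λ z → cong₂ _∧_ (<ᵇ-+-cancelˡ c x z) (<ᵇ-+-cancelˡ c z y)) ys))
    (has32after-shift c x ys)

  contains132-shift : ∀ c σ → contains132 (shift c σ) ≡ contains132 σ
  contains132-shift c []      = refl
  contains132-shift c (x ∷ σ) = cong₂ _∨_ (has32after-shift c x σ) (contains132-shift c σ)

  has32after-≥ : ∀ x ys → All (_≤ x) ys → has32after x ys ≡ false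
  has32after-≥ x []       _            = refl
  has32after-≥ x (y ∷ ys) (_ ∷ ys≤x) =
    cong₂ _∨_ (any-false (All.map (≤⇒<ᵇ∧-false _) ys≤x)) (has32after-≥ x ys ys≤x)

  has32after-++-max : ∀ x A n β → All (_< x) β → All (_< n) A → has32after x (A ++ n ∷ β) ≡ has32after x A
  has32after-++-max x []      n β β<x _ =
    cong₂ _∨_ (any-false (All.map (≤⇒<ᵇ∧-false _ ∘ <⇒≤) β<x)) (has32after-≥ x β (All.map <⇒≤ β<x))
  has32after-++-max x (y ∷ A) n β β<x (y<n ∷ A<n) = cong₂ _∨_ any≡ (has32after-++-max x A n β β<x A<n)
    where
    P : ℕ → Bool
    P z = (x <ᵇ z) ∧ (z <ᵇ y)
    any≡ : any P (A ++ n ∷ β) ≡ any P A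
    any≡ = begin
        any P (A ++ n ∷ β)
      ≡⟨ any-++ P A (n ∷ β) ⟩
        any P A ∨ (((x <ᵇ n) ∧ (n <ᵇ y)) ∨ any P β)
      ≡⟨ cong (λ t → any P A ∨ (((x <ᵇ n) ∧ t) ∨ any P β)) (≤⇒<ᵇ-false (<⇒≤ y<n)) ⟩
        any P A ∨ (((x <ᵇ n) ∧ false) ∨ any P β)
      ≡⟨ cong (λ t → any P A ∨ (t ∨ any P β)) (∧-zeroʳ (x <ᵇ n)) ⟩
        any P A ∨ any P β
      ≡⟨ cong (any P A ∨_) (any-false (All.map (≤⇒<ᵇ∧-false _ ∘ <⇒≤) β<x)) ⟩
        any P A ∨ false
      ≡⟨ ∨-identityʳ _ ⟩
        any P A
      ∎
      where open ≡-Reasoning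

  avoids132-++-max : ∀ A n β → Avoids132 A → Avoids132 β → All (λ a → All (_< a) β) A →
                     All (_< n) A → All (_< n) β → Avoids132 (A ++ n ∷ β)
  avoids132-++-max []      n β _ avβ _ _ β<n = cong₂ _∨_ (has32after-≥ n β (All.map <⇒≤ β<n)) avβ
  avoids132-++-max (x ∷ A) n β avxA avβ (β<x ∷ β<A) (x<n ∷ A<n) β<n =
    cong₂ _∨_ (trans (has32after-++-max x A n β β<x A<n) (∨-false⁻ˡ avxA))
              (avoids132-++-max A n β (∨-false⁻ʳ {has32after x A} avxA) avβ β<A A<n β<n)

  has32after-++⁻ˡ : ∀ x xs ys → has32after x (xs ++ ys) ≡ false → has32after x xs ≡ false
  has32after-++⁻ˡ x []       ys _  = refl
  has32after-++⁻ˡ x (y ∷ xs) ys eq = cong₂ _∨_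
    (∨-false⁻ˡ (trans (sym (any-++ _ xs ys)) (∨-false⁻ˡ eq)))
    (has32after-++⁻ˡ x xs ys (∨-false⁻ʳ {any (λ z → (x <ᵇ z) ∧ (z <ᵇ y)) (xs ++ ys)} eq))

  has32after-++⁻ʳ : ∀ x xs ys → has32after x (xs ++ ys) ≡ false → has32after x ys ≡ false
  has32after-++⁻ʳ x []       ys eq = eq
  has32after-++⁻ʳ x (y ∷ xs) ys eq = has32after-++⁻ʳ x xs ys (∨-false⁻ʳ {any (λ z → (x <ᵇ z) ∧ (z <ᵇ y)) (xs ++ ys)} eq)

  avoids132-++⁻ˡ : ∀ xs ys → Avoids132 (xs ++ ys) → Avoids132 xs
  avoids132-++⁻ˡ []       ys _  = refl
  avoids132-++⁻ˡ (x ∷ xs) ys av = cong₂ _∨_ (has32after-++⁻ˡ x xs ys (∨-false⁻ˡ av))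
                                            (avoids132-++⁻ˡ xs ys (∨-false⁻ʳ {has32after x (xs ++ ys)} av))

  avoids132-++⁻ʳ : ∀ xs ys → Avoids132 (xs ++ ys) → Avoids132 ys
  avoids132-++⁻ʳ []       ys av = av
  avoids132-++⁻ʳ (x ∷ xs) ys av = avoids132-++⁻ʳ xs ys (∨-false⁻ʳ {has32after x (xs ++ ys)} av)

  avoids132-across-max : ∀ A n β → Avoids132 (A ++ n ∷ β) → ∀ {a b} → a ∈ A → b ∈ β → a < b → b < n → ⊥
  avoids132-across-max (x ∷ A) n β av (here refl) b∈ x<b b<n
    with All.lookup (any-false⁻ _ β (∨-false⁻ˡ (has32after-++⁻ʳ x A (n ∷ β) (∨-false⁻ˡ av)))) b∈
  ... | pattern≡false rewrite <⇒<ᵇ-true x<b | <⇒<ᵇ-true b<n with pattern≡false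
  ... | ()
  avoids132-across-max (x ∷ A) n β av (there a∈) b∈ a<b b<n =
    avoids132-across-max A n β (∨-false⁻ʳ {has32after x (A ++ n ∷ β)} av) a∈ b∈ a<b b<n


module Avoiders where

  open import Defs
  open Counting
  open Permutations
  open Pattern132
  open import Data.Bool using (Bool; _∧_; if_then_else_; T; T?)
  open import Data.Bool.Properties using (T-∧; T-not-≡)
  open import Data.Nat using (ℕ; zero; suc; _+_; _∸_; _≤_; _<_; z≤n; s≤s; _≡ᵇ_)
  open import Data.Nat.Properties
  open import Data.List using (List; []; _∷_; _++_; map; concat; concatMap; length; filterᵇ; upTo)
  open import Data.List.Properties using (length-++; length-map; ++-cancelˡ; ∷-injectiveʳ; map-cong-local)
  open import Data.List.Membership.Propositional using (_∈_; find; lose)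
  open import Data.List.Membership.Propositional.Properties
    using (∈-map⁻; ∈-map⁺; ∈-upTo⁻; ∈-upTo⁺; ∈-concatMap⁻; ∈-concatMap⁺; ∈-filter⁻; ∈-filter⁺; ∈-∃++)
  open import Data.List.Membership.DecPropositional _≟_ using (_∈?_)
  open import Data.List.Relation.Unary.Any using (here; there)
  open import Data.List.Relation.Unary.All as All using (All; []; _∷_)
  import Data.List.Relation.Unary.All.Properties as All
  open import Data.List.Relation.Unary.AllPairs using ([]; _∷_)
  open import Data.List.Relation.Unary.Unique.Propositional using (Unique)
  import Data.List.Relation.Unary.Unique.Propositional.Properties as Unique
  open import Data.Product using (∃; ∃₂; _×_; _,_; proj₁; proj₂)
  open import Data.Empty using (⊥; ⊥-elim)
  open import Function using (_∘_)
  open import Function.Bundles using (Equivalence)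
  open import Relation.Nullary using (Dec; yes; no)
  open import Relation.Binary.Definitions using (tri<; tri≈; tri>)
  open import Relation.Binary.PropositionalEquality

  unique-++⁻ : ∀ (xs : List ℕ) {ys} → Unique (xs ++ ys) → Unique xs × Unique ys × (∀ {v} → v ∈ xs → v ∈ ys → ⊥)
  unique-++⁻ []       u           = [] , u , λ ()
  unique-++⁻ (x ∷ xs) (x∉ ∷ u) with unique-++⁻ xs u
  ... | uxs , uys , disjoint = All.++⁻ˡ xs x∉ ∷ uxs , uys , disjoint′
    where
    disjoint′ : ∀ {v} → v ∈ x ∷ xs → v ∈ _ → ⊥
    disjoint′ (here refl) v∈ys = All.lookup (All.++⁻ʳ xs x∉) v∈ys refl
    disjoint′ (there v∈)  v∈ys = disjoint v∈ v∈ys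

  glue : ℕ → ℕ → List ℕ → List ℕ → List ℕ
  glue m j α β = shift (m ∸ j) α ++ suc m ∷ β

  glued : (ℕ → List (List ℕ)) → ℕ → ℕ → List (List ℕ)
  glued avs m j = concatMap (λ α → map (glue m j α) (avs (m ∸ j))) (avs j)

  -- The first argument is fuel, which makes the recursion structural; any fuel ≥ m gives the same list.
  avoiders′ : ℕ → ℕ → List (List ℕ)
  avoiders′ _       zero    = [] ∷ []
  avoiders′ zero    (suc m) = []
  avoiders′ (suc f) (suc m) = concatMap (glued (avoiders′ f) m) (upTo (suc m))

  avoiders : ℕ → List (List ℕ)
  avoiders m = avoiders′ m m

  ∈-avoiders′⁻ : ∀ f m {σ} → σ ∈ avoiders′ (suc f) (suc m) →
                 ∃ λ j → j ≤ m × ∃₂ λ α β → α ∈ avoiders′ f j × β ∈ avoiders′ f (m ∸ j) × σ ≡ glue m j α β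
  ∈-avoiders′⁻ f m σ∈ with find (∈-concatMap⁻ (glued (avoiders′ f) m) {xs = upTo (suc m)} σ∈)
  ... | j , j∈ , σ∈′ with find (∈-concatMap⁻ (λ α → map (glue m j α) (avoiders′ f (m ∸ j))) {xs = avoiders′ f j} σ∈′)
  ... | α , α∈ , σ∈″ with ∈-map⁻ (glue m j α) σ∈″
  ... | β , β∈ , σ≡ = j , ≤-pred (∈-upTo⁻ j∈) , α , β , α∈ , β∈ , σ≡

  ∈-avoiders′⁺ : ∀ f m j {α β} → j ≤ m → α ∈ avoiders′ f j → β ∈ avoiders′ f (m ∸ j) →
                 glue m j α β ∈ avoiders′ (suc f) (suc m)
  ∈-avoiders′⁺ f m j {α} j≤m α∈ β∈ =
    ∈-concatMap⁺ (glued (avoiders′ f) m) {xs = upTo (suc m)} (lose (∈-upTo⁺ (s≤s j≤m))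
      (∈-concatMap⁺ (λ α → map (glue m j α) (avoiders′ f (m ∸ j))) {xs = avoiders′ f j}
        (lose α∈ (∈-map⁺ (glue m j α) β∈))))

  shift-bounds : ∀ {m j α} → j ≤ m → All (InRange j) α → All (λ a → m ∸ j < a × a ≤ m) (shift (m ∸ j) α)
  shift-bounds {m} {j} j≤m = All.map⁺ ∘ All.map λ { {x} (1≤x , x≤j) →
    subst (_≤ m ∸ j + x) (+-comm (m ∸ j) 1) (+-monoʳ-≤ (m ∸ j) 1≤x) ,
    subst (m ∸ j + x ≤_) (m∸n+n≡m j≤m) (+-monoʳ-≤ (m ∸ j) x≤j) }

  glue-isPerm : ∀ {m j α β} → j ≤ m → IsPerm j α → IsPerm (m ∸ j) β → IsPerm (suc m) (glue m j α β)
  glue-isPerm {m} {j} {α} {β} j≤m permα permβ = record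
    { length≡ = trans (length-++ (shift c α))
                      (trans (cong₂ (λ u v → u + suc v) (trans (length-map (c +_) α) (IsPerm.length≡ permα)) (IsPerm.length≡ permβ))
                             (trans (+-suc j c) (cong suc (m+[n∸m]≡n j≤m))))
    ; inRange = All.++⁺ (All.map (λ (c<a , a≤m) → ≤-trans (s≤s z≤n) c<a , m≤n⇒m≤1+n a≤m) shifted)
                        ((s≤s z≤n , ≤-refl) ∷ All.map (λ (1≤b , b≤c) → 1≤b , m≤n⇒m≤1+n (≤-trans b≤c (m∸n≤m m j))) (IsPerm.inRange permβ))
    ; unique  = Unique.++⁺ (Unique.map⁺ (+-cancelˡ-≡ c _ _) (IsPerm.unique permα))
                           (All.tabulate (λ b∈ b≡ → n≮n m (subst (_≤ m) (sym b≡) (≤-trans (proj₂ (All.lookup (IsPerm.inRange permβ) b∈)) (m∸n≤m m j))))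
                             ∷ IsPerm.unique permβ)
                           (λ { (a∈ , here refl) → n≮n m (proj₂ (All.lookup shifted a∈))
                              ; (a∈ , there b∈)  → n≮n c (≤-trans (proj₁ (All.lookup shifted a∈)) (proj₂ (All.lookup (IsPerm.inRange permβ) b∈))) })
    }
    where
    c : ℕ
    c = m ∸ j
    shifted : All (λ a → c < a × a ≤ m) (shift c α)
    shifted = shift-bounds j≤m (IsPerm.inRange permα)

  glue-avoids132 : ∀ {m j α β} → j ≤ m → All (InRange j) α → All (InRange (m ∸ j)) β →
                   Avoids132 α → Avoids132 β → Avoids132 (glue m j α β)
  glue-avoids132 {m} {j} {α} {β} j≤m α∈range β∈range avα avβ = avoids132-++-max (shift (m ∸ j) α) (suc m) β
    (trans (contains132-shift (m ∸ j) α) avα) avβ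
    (All.map (λ (c<a , _) → All.map (λ (_ , b≤c) → <-≤-trans (s≤s b≤c) c<a) β∈range) shifted)
    (All.map (λ (_ , a≤m) → s≤s a≤m) shifted)
    (All.map (λ (_ , b≤c) → s≤s (≤-trans b≤c (m∸n≤m m j))) β∈range)
    where
    shifted : All (λ a → m ∸ j < a × a ≤ m) (shift (m ∸ j) α)
    shifted = shift-bounds j≤m α∈range

  avoiders′-sound : ∀ f m {σ} → σ ∈ avoiders′ f m → IsPerm m σ × Avoids132 σ
  avoiders′-sound f       zero    (here refl) = record { length≡ = refl ; inRange = [] ; unique = [] } , refl
  avoiders′-sound (suc f) (suc m) σ∈ with ∈-avoiders′⁻ f m σ∈
  ... | j , j≤m , α , β , α∈ , β∈ , refl with avoiders′-sound f j α∈ | avoiders′-sound f (m ∸ j) β∈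
  ... | permα , avα | permβ , avβ =
    glue-isPerm j≤m permα permβ , glue-avoids132 j≤m (IsPerm.inRange permα) (IsPerm.inRange permβ) avα avβ

  before : ℕ → List ℕ → List ℕ
  before n []       = []
  before n (x ∷ xs) = if x ≡ᵇ n then [] else x ∷ before n xs

  before-++-∷ : ∀ n A β → All (_≢ n) A → before n (A ++ n ∷ β) ≡ A
  before-++-∷ n []      β _          rewrite ≡ᵇ-refl n      = refl
  before-++-∷ n (x ∷ A) β (x≢n ∷ A≢n) rewrite ≢⇒≡ᵇ-false x≢n = cong (x ∷_) (before-++-∷ n A β A≢n)

  unshift-shift : ∀ c xs → map (_∸ c) (shift c xs) ≡ xs
  unshift-shift c []       = refl
  unshift-shift c (x ∷ xs) = cong₂ _∷_ (m+n∸m≡n c x) (unshift-shift c xs)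

  shift-unshift : ∀ c {xs} → All (c ≤_) xs → shift c (map (_∸ c) xs) ≡ xs
  shift-unshift c []           = refl
  shift-unshift c (c≤x ∷ c≤xs) = cong₂ _∷_ (m+[n∸m]≡n c≤x) (shift-unshift c c≤xs)

  -- A glued word is decoded from the position of its maximum: j is the length of the prefix before it.
  before-glue : ∀ {m j α} β → j ≤ m → IsPerm j α → before (suc m) (glue m j α β) ≡ shift (m ∸ j) α
  before-glue {m} {j} {α} β j≤m permα = before-++-∷ (suc m) (shift (m ∸ j) α) β
    (All.map (λ (_ , a≤m) a≡ → n≮n m (subst (_≤ m) a≡ a≤m)) (shift-bounds j≤m (IsPerm.inRange permα)))

  unique-avoiders′ : ∀ f m → Unique (avoiders′ f m)
  unique-avoiders′ f       zero    = [] ∷ []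
  unique-avoiders′ zero    (suc m) = []
  unique-avoiders′ (suc f) (suc m) =
    unique-concatMap (glued (avoiders′ f) m) (length ∘ before (suc m)) (Unique.upTo⁺ (suc m))
      (All.tabulate (unique-glued ∘ ≤-pred ∘ ∈-upTo⁻))
      (All.tabulate (λ j∈ → All.tabulate (decode-j (≤-pred (∈-upTo⁻ j∈)))))
    where
    member : ∀ {j σ} → σ ∈ glued (avoiders′ f) m j →
             ∃₂ λ α β → α ∈ avoiders′ f j × σ ≡ glue m j α β
    member {j} σ∈ with find (∈-concatMap⁻ (λ α → map (glue m j α) (avoiders′ f (m ∸ j))) {xs = avoiders′ f j} σ∈)
    ... | α , α∈ , σ∈′ with ∈-map⁻ (glue m j α) σ∈′
    ... | β , _ , σ≡ = α , β , α∈ , σ≡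
    decode-j : ∀ {j σ} → j ≤ m → σ ∈ glued (avoiders′ f) m j → length (before (suc m) σ) ≡ j
    decode-j {j} j≤m σ∈ with member {j} σ∈
    ... | α , β , α∈ , refl with proj₁ (avoiders′-sound f j α∈)
    ... | permα = trans (cong length (before-glue β j≤m permα)) (trans (length-map _ α) (IsPerm.length≡ permα))
    unique-glued : ∀ {j} → j ≤ m → Unique (glued (avoiders′ f) m j)
    unique-glued {j} j≤m =
      unique-concatMap (λ α → map (glue m j α) (avoiders′ f (m ∸ j))) (map (_∸ (m ∸ j)) ∘ before (suc m))
        (unique-avoiders′ f j)
        (All.tabulate (λ {α} _ → Unique.map⁺ (∷-injectiveʳ ∘ ++-cancelˡ (shift (m ∸ j) α) _ _) (unique-avoiders′ f (m ∸ j))))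
        (All.tabulate (λ {α} α∈ → All.tabulate (λ σ∈ → decode-α α∈ σ∈)))
      where
      decode-α : ∀ {α σ} → α ∈ avoiders′ f j → σ ∈ map (glue m j α) (avoiders′ f (m ∸ j)) →
                 map (_∸ (m ∸ j)) (before (suc m) σ) ≡ α
      decode-α {α} α∈ σ∈ with ∈-map⁻ (glue m j α) σ∈
      ... | β , _ , refl = trans (cong (map (_∸ (m ∸ j))) (before-glue β j≤m (proj₁ (avoiders′-sound f j α∈))))
                                 (unshift-shift (m ∸ j) α)

  max∈perm : ∀ {m σ} → IsPerm (suc m) σ → suc m ∈ σ
  max∈perm {m} {σ} perm with suc m ∈? σ
  ... | yes m+1∈σ = m+1∈σ
  ... | no  m+1∉σ = ⊥-elim (n≮n m (subst (_≤ m) (IsPerm.length≡ perm)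
          (unique-interval⇒length≤ 0 m (IsPerm.unique perm)
            (All.tabulate (λ {x} x∈ → let (1≤x , x≤m+1) = All.lookup (IsPerm.inRange perm) x∈ in
              1≤x , ≤-pred (≤∧≢⇒< x≤m+1 (λ { refl → m+1∉σ x∈ })))))))

  module MaxSplit {m : ℕ} (A β : List ℕ) (perm : IsPerm (suc m) (A ++ suc m ∷ β))
                  (av : Avoids132 (A ++ suc m ∷ β)) where

    private
      parts : Unique A × Unique (suc m ∷ β) × (∀ {v} → v ∈ A → v ∈ suc m ∷ β → ⊥)
      parts = unique-++⁻ A (IsPerm.unique perm)
      disjoint : ∀ {v} → v ∈ A → v ∈ suc m ∷ β → ⊥
      disjoint = proj₂ (proj₂ parts)
      uniqueTail : Unique (suc m ∷ β)
      uniqueTail = proj₁ (proj₂ parts)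

    unique-prefix : Unique A
    unique-prefix = proj₁ parts

    unique-suffix : Unique β
    unique-suffix with uniqueTail
    ... | _ ∷ u = u

    private
      A∈range : All (InRange (suc m)) A
      A∈range = All.++⁻ˡ A (IsPerm.inRange perm)

      β∈range : All (InRange (suc m)) β
      β∈range with All.++⁻ʳ A (IsPerm.inRange perm)
      ... | _ ∷ r = r

      a≤m : ∀ {a} → a ∈ A → a ≤ m
      a≤m a∈ = ≤-pred (≤∧≢⇒< (proj₂ (All.lookup A∈range a∈)) λ { refl → disjoint a∈ (here refl) })

      b≤m : ∀ {b} → b ∈ β → b ≤ m
      b≤m b∈ with uniqueTail
      ... | m+1∉β ∷ _ = ≤-pred (≤∧≢⇒< (proj₂ (All.lookup β∈range b∈)) λ { refl → All.lookup m+1∉β b∈ refl })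

      b<a : ∀ {a b} → a ∈ A → b ∈ β → b < a
      b<a {a} {b} a∈ b∈ with <-cmp a b
      ... | tri< a<b _ _    = ⊥-elim (avoids132-across-max A (suc m) β av a∈ b∈ a<b (s≤s (b≤m b∈)))
      ... | tri≈ _ refl _   = ⊥-elim (disjoint a∈ (there b∈))
      ... | tri> _ _ b<a    = b<a

    length-split : length A + length β ≡ m
    length-split = suc-injective (trans (sym (+-suc (length A) (length β)))
                                        (trans (sym (length-++ A)) (IsPerm.length≡ perm)))

    m∸|A|≡|β| : m ∸ length A ≡ length β
    m∸|A|≡|β| = trans (cong (_∸ length A) (sym length-split)) (m+n∸m≡n (length A) (length β))

    m∸|β|≡|A| : m ∸ length β ≡ length A
    m∸|β|≡|A| = trans (cong (_∸ length β) (sym length-split)) (m+n∸n≡m (length A) (length β))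

    -- Counting: the entries of β lie in [1, a) for each a ∈ A, those of A in (b, m] for each b ∈ β.
    prefix-bounds : All (λ a → length β < a × a ≤ m) A
    prefix-bounds = All.tabulate λ {a} a∈ →
      subst (_≤ a) (+-comm (length β) 1)
        (m≤o∸n⇒m+n≤o (length β) (proj₁ (All.lookup A∈range a∈))
          (unique-interval⇒length≤ 0 (a ∸ 1) unique-suffix
            (All.tabulate λ b∈ → proj₁ (All.lookup β∈range b∈) , <⇒≤pred (subst (_ <_) (sym (1+[a∸1]≡a a∈)) (b<a a∈ b∈))))) ,
      a≤m a∈
      where
      1+[a∸1]≡a : ∀ {a} → a ∈ A → suc (a ∸ 1) ≡ a
      1+[a∸1]≡a a∈ = m+[n∸m]≡n (proj₁ (All.lookup A∈range a∈))

    suffix-bounds : All (InRange (length β)) β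
    suffix-bounds = All.tabulate λ {b} b∈ → proj₁ (All.lookup β∈range b∈) ,
      subst (b ≤_) m∸|A|≡|β|
        (m+n≤o⇒m≤o∸n b (subst (_≤ m) (+-comm (length A) b)
          (m≤o∸n⇒m+n≤o (length A) (b≤m b∈)
            (unique-interval⇒length≤ b m unique-prefix (All.tabulate λ a∈ → b<a a∈ b∈ , a≤m a∈)))))

    standardised-prefix : List ℕ
    standardised-prefix = map (_∸ length β) A

    shift-standardised-prefix : shift (length β) standardised-prefix ≡ A
    shift-standardised-prefix = shift-unshift (length β) (All.map (<⇒≤ ∘ proj₁) prefix-bounds)

    isPerm-prefix : IsPerm (length A) standardised-prefix
    isPerm-prefix = record
      { length≡ = length-map _ A
      ; inRange = All.map⁺ (All.map (λ (β<a , a≤m) → m<n⇒0<n∸m β<a ,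
                    subst (_ ≤_) m∸|β|≡|A| (∸-monoˡ-≤ (length β) a≤m)) prefix-bounds)
      ; unique  = Unique.map⁻ (subst Unique (sym shift-standardised-prefix) unique-prefix)
      }

    avoids132-prefix : Avoids132 standardised-prefix
    avoids132-prefix = trans (sym (contains132-shift (length β) standardised-prefix))
      (subst Avoids132 (sym shift-standardised-prefix) (avoids132-++⁻ˡ A (suc m ∷ β) av))

    isPerm-suffix : IsPerm (length β) β
    isPerm-suffix = record { length≡ = refl ; inRange = suffix-bounds ; unique = unique-suffix }

    avoids132-suffix : Avoids132 β
    avoids132-suffix = ∨-false⁻ʳ {has32after (suc m) β} (avoids132-++⁻ʳ A (suc m ∷ β) av)

  avoiders′-complete : ∀ f m {σ} → m ≤ f → IsPerm m σ → Avoids132 σ → σ ∈ avoiders′ f m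
  avoiders′-complete f       zero    {[]}    _ _    _ = here refl
  avoiders′-complete f       zero    {_ ∷ _} _ perm _ with IsPerm.length≡ perm
  ... | ()
  avoiders′-complete (suc f) (suc m) {σ} (s≤s m≤f) perm av with ∈-∃++ (max∈perm perm)
  ... | A , β , refl = subst (_∈ avoiders′ (suc f) (suc m)) glue≡
    (∈-avoiders′⁺ f m (length A) |A|≤m
      (avoiders′-complete f (length A) (≤-trans |A|≤m m≤f) isPerm-prefix avoids132-prefix)
      (avoiders′-complete f (m ∸ length A) (≤-trans (m∸n≤m m (length A)) m≤f)
        (subst (λ k → IsPerm k β) (sym m∸|A|≡|β|) isPerm-suffix) avoids132-suffix))
    where
    open MaxSplit A β perm av
    |A|≤m : length A ≤ m
    |A|≤m = subst (length A ≤_) length-split (m≤m+n (length A) (length β))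
    glue≡ : glue m (length A) standardised-prefix β ≡ A ++ suc m ∷ β
    glue≡ = cong (_++ suc m ∷ β) (trans (cong (λ c → shift c standardised-prefix) m∸|A|≡|β|) shift-standardised-prefix)

  glued-cong : ∀ {avs avs′ : ℕ → List (List ℕ)} m j →
               avs j ≡ avs′ j → avs (m ∸ j) ≡ avs′ (m ∸ j) → glued avs m j ≡ glued avs′ m j
  glued-cong m j eq₁ eq₂ rewrite eq₁ | eq₂ = refl

  avoiders′-stable : ∀ f f′ m → m ≤ f → m ≤ f′ → avoiders′ f m ≡ avoiders′ f′ m
  avoiders′-stable f       f′       zero    _         _          = refl
  avoiders′-stable (suc f) (suc f′) (suc m) (s≤s m≤f) (s≤s m≤f′) =
    cong concat (map-cong-local (All.tabulate λ {j} j∈ → let j≤m = ≤-pred (∈-upTo⁻ j∈) in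
      glued-cong {avoiders′ f} {avoiders′ f′} m j (avoiders′-stable f f′ j (≤-trans j≤m m≤f) (≤-trans j≤m m≤f′))
                                                   (avoiders′-stable f f′ (m ∸ j) (≤-trans (m∸n≤m m j) m≤f) (≤-trans (m∸n≤m m j) m≤f′))))

  avoiders-unfold : ∀ m → avoiders (suc m) ≡ concatMap (glued avoiders m) (upTo (suc m))
  avoiders-unfold m =
    cong concat (map-cong-local (All.tabulate λ {j} j∈ → let j≤m = ≤-pred (∈-upTo⁻ j∈) in
      glued-cong {avoiders′ m} {avoiders} m j (avoiders′-stable m j j j≤m ≤-refl) (avoiders′-stable m (m ∸ j) (m ∸ j) (m∸n≤m m j) ≤-refl)))

  avoiders-isPerm : ∀ m → All (IsPerm m) (avoiders m)
  avoiders-isPerm m = All.tabulate (proj₁ ∘ avoiders′-sound m m)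

  -- Both lists are duplicate-free and have the same members.
  length-filter-perms : ∀ k (Q : List ℕ → Bool) →
                        length (filterᵇ (λ σ → avoids132 σ ∧ Q σ) (perms k)) ≡ count Q (avoiders k)
  length-filter-perms k Q = trans (≤-antisym (unique-⊆⇒length≤ unique-lhs lhs⊆rhs) (unique-⊆⇒length≤ unique-rhs rhs⊆lhs))
                                  (length-filterᵇ Q (avoiders k))
    where
    P? : ∀ σ → Dec (T (avoids132 σ ∧ Q σ))
    P? = T? ∘ λ σ → avoids132 σ ∧ Q σ
    unique-lhs : Unique (filterᵇ (λ σ → avoids132 σ ∧ Q σ) (perms k))
    unique-lhs = Unique.filter⁺ P? (unique-perms k)
    unique-rhs : Unique (filterᵇ Q (avoiders k))
    unique-rhs = Unique.filter⁺ (T? ∘ Q) (unique-avoiders′ k k)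
    lhs⊆rhs : ∀ {σ} → σ ∈ filterᵇ (λ σ → avoids132 σ ∧ Q σ) (perms k) → σ ∈ filterᵇ Q (avoiders k)
    lhs⊆rhs σ∈ with ∈-filter⁻ P? {xs = perms k} σ∈
    ... | σ∈perms , t with Equivalence.to T-∧ t
    ... | tav , tQ = ∈-filter⁺ (T? ∘ Q) {xs = avoiders k}
                       (avoiders′-complete k k ≤-refl (∈-perms⁻ σ∈perms) (Equivalence.to T-not-≡ tav)) tQ
    rhs⊆lhs : ∀ {σ} → σ ∈ filterᵇ Q (avoiders k) → σ ∈ filterᵇ (λ σ → avoids132 σ ∧ Q σ) (perms k)
    rhs⊆lhs σ∈ with ∈-filter⁻ (T? ∘ Q) {xs = avoiders k} σ∈
    ... | σ∈avs , tQ with avoiders′-sound k k σ∈avs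
    ... | perm , av = ∈-filter⁺ P? {xs = perms k} (∈-perms⁺ perm) (Equivalence.from T-∧ (Equivalence.from T-not-≡ av , tQ))


module Adjacency where

  open import Defs
  open Permutations
  open Pattern132
  open import Data.Bool using (Bool; true; false; _∧_; _∨_)
  open import Data.Bool.Properties using (∨-identityʳ; ∧-zeroʳ; ∧-identityʳ; ∧-assoc)
  open import Data.Nat using (ℕ; zero; suc; _+_; _≤_; _<_; _≡ᵇ_)
  open import Data.Nat.Properties
  open import Data.List using (List; []; _∷_; _++_; _∷ʳ_; initLast; _∷ʳ′_)
  open import Data.List.Properties using (++-assoc)
  open import Data.List.Relation.Unary.All as All using (All; []; _∷_)
  import Data.List.Relation.Unary.All.Properties as All
  open import Data.Empty using (⊥-elim)
  open import Relation.Binary.PropositionalEquality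

  -- p (resp. q) records whether the first (resp. last) entry already has a neighbour outside the word.
  goodBetween : Bool → List ℕ → Bool → Bool
  goodBetween p []          q = true
  goodBetween p (x ∷ [])    q = p ∨ q
  goodBetween p (x ∷ y ∷ r) q = (p ∨ adj x y) ∧ goodBetween (adj x y) (y ∷ r) q

  lastIs : ℕ → List ℕ → Bool
  lastIs n []          = false
  lastIs n (x ∷ [])    = x ≡ᵇ n
  lastIs n (x ∷ y ∷ r) = lastIs n (y ∷ r)

  ≡ᵇ-sym : ∀ m n → (m ≡ᵇ n) ≡ (n ≡ᵇ m)
  ≡ᵇ-sym zero    zero    = refl
  ≡ᵇ-sym zero    (suc n) = refl
  ≡ᵇ-sym (suc m) zero    = refl
  ≡ᵇ-sym (suc m) (suc n) = ≡ᵇ-sym m n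

  ≡ᵇ-+-cancelˡ : ∀ c m n → ((c + m) ≡ᵇ (c + n)) ≡ (m ≡ᵇ n)
  ≡ᵇ-+-cancelˡ zero    m n = refl
  ≡ᵇ-+-cancelˡ (suc c) m n = ≡ᵇ-+-cancelˡ c m n

  goodFrom≡goodBetween : ∀ p σ → goodFrom p σ ≡ goodBetween p σ false
  goodFrom≡goodBetween p []          = refl
  goodFrom≡goodBetween p (x ∷ [])    = sym (∨-identityʳ p)
  goodFrom≡goodBetween p (x ∷ y ∷ r) = cong ((p ∨ adj x y) ∧_) (goodFrom≡goodBetween (adj x y) (y ∷ r))

  goodBetween-++ : ∀ p xs x y ys q →
                   goodBetween p (xs ++ x ∷ y ∷ ys) q ≡ goodBetween p (xs ∷ʳ x) (adj x y) ∧ goodBetween (adj x y) (y ∷ ys) q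
  goodBetween-++ p []          x y ys q = refl
  goodBetween-++ p (z ∷ [])    x y ys q = sym (∧-assoc (p ∨ adj z x) (adj z x ∨ adj x y) _)
  goodBetween-++ p (z ∷ w ∷ r) x y ys q =
    trans (cong ((p ∨ adj z w) ∧_) (goodBetween-++ (adj z w) (w ∷ r) x y ys q)) (sym (∧-assoc (p ∨ adj z w) _ _))

  lastIs-++-∷ : ∀ n xs y ys → lastIs n (xs ++ y ∷ ys) ≡ lastIs n (y ∷ ys)
  lastIs-++-∷ n []          y ys = refl
  lastIs-++-∷ n (x ∷ [])    y ys = refl
  lastIs-++-∷ n (x ∷ x′ ∷ xs) y ys = lastIs-++-∷ n (x′ ∷ xs) y ys

  lastIs-< : ∀ n {xs} → All (_< n) xs → lastIs n xs ≡ false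
  lastIs-< n []                    = refl
  lastIs-< n (x<n ∷ [])            = ≢⇒≡ᵇ-false (<⇒≢ x<n)
  lastIs-< n (_ ∷ xs<n@(_ ∷ _))    = lastIs-< n xs<n

  adj-+ : ∀ c x y → adj (c + x) (c + y) ≡ adj x y
  adj-+ c x y = cong₂ _∨_ (trans (cong ((c + x) ≡ᵇ_) (sym (+-suc c y))) (≡ᵇ-+-cancelˡ c x (suc y)))
                          (trans (cong ((c + y) ≡ᵇ_) (sym (+-suc c x))) (≡ᵇ-+-cancelˡ c y (suc x)))

  goodBetween-shift : ∀ c p σ q → goodBetween p (shift c σ) q ≡ goodBetween p σ q
  goodBetween-shift c p []          q = refl
  goodBetween-shift c p (x ∷ [])    q = refl
  goodBetween-shift c p (x ∷ y ∷ r) q =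
    trans (cong ((p ∨ adj (c + x) (c + y)) ∧_) (goodBetween-shift c (adj (c + x) (c + y)) (y ∷ r) q))
          (cong (λ b → (p ∨ b) ∧ goodBetween b (y ∷ r) q) (adj-+ c x y))

  lastIs-shift : ∀ c n σ → lastIs (c + n) (shift c σ) ≡ lastIs n σ
  lastIs-shift c n []          = refl
  lastIs-shift c n (x ∷ [])    = ≡ᵇ-+-cancelˡ c x n
  lastIs-shift c n (x ∷ y ∷ r) = lastIs-shift c n (y ∷ r)

  adj-maxˡ : ∀ {m y} → y ≤ m → adj (suc m) y ≡ (y ≡ᵇ m)
  adj-maxˡ {m} {y} y≤m = trans (cong₂ _∨_ (≡ᵇ-sym m y) (≢⇒≡ᵇ-false {y} {suc (suc m)} λ y≡ → n≮n m (≤-trans (n≤1+n (suc m)) (subst (_≤ m) y≡ y≤m))))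
                               (∨-identityʳ _)

  adj-maxʳ : ∀ {m x} → x ≤ m → adj x (suc m) ≡ (x ≡ᵇ m)
  adj-maxʳ {m} {x} x≤m = cong₂ _∨_ (≢⇒≡ᵇ-false {x} {suc (suc m)} λ x≡ → n≮n (suc m) (subst (_≤ suc m) x≡ (m≤n⇒m≤1+n x≤m)))
                                    (≡ᵇ-sym m x)

  goodFrom-false-max∷ : ∀ m β → All (_≤ m) β → goodFrom false (suc m ∷ β) ≡ headIs m β ∧ goodFrom true β
  goodFrom-false-max∷ m []      _         = refl
  goodFrom-false-max∷ m (y ∷ β) (y≤m ∷ _) rewrite adj-maxˡ y≤m with y ≡ᵇ m
  ... | true  = refl
  ... | false = refl

  goodFrom-true-max∷ : ∀ m β → All (_≤ m) β → goodFrom true (suc m ∷ β) ≡ goodFrom (headIs m β) β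
  goodFrom-true-max∷ m []      _         = refl
  goodFrom-true-max∷ m (y ∷ β) (y≤m ∷ _) rewrite adj-maxˡ y≤m = refl

  goodBetween-max∷ : ∀ m b β → All (_< m) β → goodBetween b (suc m ∷ β) false ≡ b ∧ goodFrom false β
  goodBetween-max∷ m b []      _ = trans (∨-identityʳ b) (sym (∧-identityʳ b))
  goodBetween-max∷ m b (y ∷ β) (y<m ∷ _) rewrite adj-maxˡ (<⇒≤ y<m) | ≢⇒≡ᵇ-false (<⇒≢ y<m) | ∨-identityʳ b =
    cong (b ∧_) (sym (goodFrom≡goodBetween false (y ∷ β)))

  -- The maximum m+1 can only be adjacent to m, which lies in the prefix once that is nonempty.
  goodFrom-++-max∷ : ∀ m A β → A ≢ [] → All (_≤ m) A → All (_< m) β →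
                     goodFrom false (A ++ suc m ∷ β) ≡ (lastIs m A ∧ goodBetween false A true) ∧ goodFrom false β
  goodFrom-++-max∷ m A β A≢[] A≤m β<m with initLast A
  ... | []         = ⊥-elim (A≢[] refl)
  ... | A′ ∷ʳ′ x = begin
      goodFrom false ((A′ ∷ʳ x) ++ suc m ∷ β)
    ≡⟨ cong (goodFrom false) (++-assoc A′ (x ∷ []) (suc m ∷ β)) ⟩
      goodFrom false (A′ ++ x ∷ suc m ∷ β)
    ≡⟨ goodFrom≡goodBetween false (A′ ++ x ∷ suc m ∷ β) ⟩
      goodBetween false (A′ ++ x ∷ suc m ∷ β) false
    ≡⟨ goodBetween-++ false A′ x (suc m) β false ⟩
      goodBetween false (A′ ∷ʳ x) (adj x (suc m)) ∧ goodBetween (adj x (suc m)) (suc m ∷ β) false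
    ≡⟨ cong (λ b → goodBetween false (A′ ∷ʳ x) b ∧ goodBetween b (suc m ∷ β) false) (adj-maxʳ x≤m) ⟩
      goodBetween false (A′ ∷ʳ x) (x ≡ᵇ m) ∧ goodBetween (x ≡ᵇ m) (suc m ∷ β) false
    ≡⟨ cong (goodBetween false (A′ ∷ʳ x) (x ≡ᵇ m) ∧_) (goodBetween-max∷ m (x ≡ᵇ m) β β<m) ⟩
      goodBetween false (A′ ∷ʳ x) (x ≡ᵇ m) ∧ ((x ≡ᵇ m) ∧ goodFrom false β)
    ≡⟨ flag-out (x ≡ᵇ m) ⟩
      ((x ≡ᵇ m) ∧ goodBetween false (A′ ∷ʳ x) true) ∧ goodFrom false β
    ≡⟨ cong (λ t → (t ∧ goodBetween false (A′ ∷ʳ x) true) ∧ goodFrom false β) (sym (lastIs-++-∷ m A′ x [])) ⟩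
      (lastIs m (A′ ∷ʳ x) ∧ goodBetween false (A′ ∷ʳ x) true) ∧ goodFrom false β
    ∎
    where
    open ≡-Reasoning
    x≤m : x ≤ m
    x≤m with All.++⁻ʳ A′ A≤m
    ... | x≤m ∷ _ = x≤m
    flag-out : ∀ b → goodBetween false (A′ ∷ʳ x) b ∧ (b ∧ goodFrom false β) ≡ (b ∧ goodBetween false (A′ ∷ʳ x) true) ∧ goodFrom false β
    flag-out true  = refl
    flag-out false = ∧-zeroʳ _

  goodBetween-∷ʳ-max : ∀ m α q → All (_≤ m) α →
                       goodBetween false (α ∷ʳ suc m) q ≡ goodBetween false α (lastIs m α) ∧ (lastIs m α ∨ q)
  goodBetween-∷ʳ-max m α q α≤m with initLast α
  ... | []         = refl
  ... | A′ ∷ʳ′ x = begin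
      goodBetween false ((A′ ∷ʳ x) ∷ʳ suc m) q
    ≡⟨ cong (λ t → goodBetween false t q) (++-assoc A′ (x ∷ []) (suc m ∷ [])) ⟩
      goodBetween false (A′ ++ x ∷ suc m ∷ []) q
    ≡⟨ goodBetween-++ false A′ x (suc m) [] q ⟩
      goodBetween false (A′ ∷ʳ x) (adj x (suc m)) ∧ (adj x (suc m) ∨ q)
    ≡⟨ cong (λ b → goodBetween false (A′ ∷ʳ x) b ∧ (b ∨ q)) (trans (adj-maxʳ x≤m) (sym (lastIs-++-∷ m A′ x []))) ⟩
      goodBetween false (A′ ∷ʳ x) (lastIs m (A′ ∷ʳ x)) ∧ (lastIs m (A′ ∷ʳ x) ∨ q)
    ∎
    where
    open ≡-Reasoning
    x≤m : x ≤ m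
    x≤m with All.++⁻ʳ A′ α≤m
    ... | x≤m ∷ _ = x≤m


module Recurrences where

  open import Defs
  open Counting
  open Permutations
  open Pattern132
  open Avoiders
  open Adjacency
  open import Data.Bool using (Bool; true; false; _∧_; _∨_; not)
  open import Data.Bool.Properties using (∧-identityʳ; ∧-zeroʳ; ∨-zeroʳ)
  open import Data.Nat using (ℕ; zero; suc; _+_; _*_; _∸_; _≤_; _<_; z≤n; s≤s)
  open import Data.Nat.Properties
  open import Data.Nat.ListAction using (sum)
  open import Data.List using (List; []; _∷_; _∷ʳ_; map; concatMap; length; upTo; applyUpTo)
  open import Data.List.Properties using (map-id; length-map)
  open import Data.List.Membership.Propositional using (_∈_)
  open import Data.List.Membership.Propositional.Properties using (∈-applyUpTo⁻)
  open import Data.List.Relation.Unary.All as All using (All; []; _∷_)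
  import Data.List.Relation.Unary.All.Properties as All
  open import Data.Product using (_×_; _,_; proj₂)
  open import Function using (_∘_)
  open import Data.Empty using (⊥-elim)
  open import Relation.Binary.PropositionalEquality

  -- H and L count avoiders whose maximum is first and last; a ⁺ means that end entry already has a neighbour.
  G H H⁺ L L⁺ : ℕ → ℕ
  G  m = count (goodFrom false) (avoiders m)
  H  m = count (λ σ → headIs m σ ∧ goodFrom false σ) (avoiders m)
  H⁺ m = count (λ σ → headIs m σ ∧ goodFrom true σ) (avoiders m)
  L  m = count (λ σ → lastIs m σ ∧ goodBetween false σ false) (avoiders m)
  L⁺ m = count (λ σ → lastIs m σ ∧ goodBetween false σ true) (avoiders m)

  avoiders-≤ : ∀ m → All (All (_≤ m)) (avoiders m)
  avoiders-≤ m = All.map (All.map proj₂ ∘ IsPerm.inRange) (avoiders-isPerm m)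

  count-glued : (List ℕ → Bool) → ℕ → ℕ → ℕ
  count-glued Q m j = sum (map (λ α → count Q (map (glue m j α) (avoiders (m ∸ j)))) (avoiders j))

  count-avoiders-suc : ∀ Q m → count Q (avoiders (suc m)) ≡ sum (map (count-glued Q m) (upTo (suc m)))
  count-avoiders-suc Q m = begin
      count Q (avoiders (suc m))
    ≡⟨ cong (count Q) (avoiders-unfold m) ⟩
      count Q (concatMap (glued avoiders m) (upTo (suc m)))
    ≡⟨ count-concatMap Q (glued avoiders m) (upTo (suc m)) ⟩
      sum (map (count Q ∘ glued avoiders m) (upTo (suc m)))
    ≡⟨ sum-map-cong-local {f = count Q ∘ glued avoiders m} {xs = upTo (suc m)} (All.tabulate λ {j} _ →
         count-concatMap Q (λ α → map (glue m j α) (avoiders (m ∸ j))) (avoiders j)) ⟩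
      sum (map (count-glued Q m) (upTo (suc m)))
    ∎
    where
    open ≡-Reasoning

  count-glued-false : ∀ Q m j → All (λ α → All (λ β → Q (glue m j α β) ≡ false) (avoiders (m ∸ j))) (avoiders j) →
                      count-glued Q m j ≡ 0
  count-glued-false Q m j Q≡false =
    sum-map-zero (All.map (λ {α} row → trans (count-map Q (glue m j α) (avoiders (m ∸ j))) (count-false row)) Q≡false)

  count-max-first : ∀ (P : List ℕ → Bool) m →
                    count (λ σ → headIs (suc m) σ ∧ P σ) (avoiders (suc m)) ≡ count (λ β → P (suc m ∷ β)) (avoiders m)
  count-max-first P m = begin
      count Q (avoiders (suc m))
    ≡⟨ count-avoiders-suc Q m ⟩
      sum (map (count-glued Q m) (upTo (suc m)))
    ≡⟨ sum-upTo-first (count-glued Q m) m (λ i i<m → count-glued-false Q m (suc i)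
         (All.map (λ permα → All.tabulate λ _ → false-∧ _ (head-not-max i<m permα)) (avoiders-isPerm (suc i)))) ⟩
      count Q (map (glue m 0 []) (avoiders m)) + 0
    ≡⟨ +-identityʳ _ ⟩
      count Q (map (glue m 0 []) (avoiders m))
    ≡⟨ count-map Q (glue m 0 []) (avoiders m) ⟩
      count (Q ∘ (suc m ∷_)) (avoiders m)
    ≡⟨ count-cong-local {xs = avoiders m} (All.tabulate λ _ → true-∧ _ (≡ᵇ-refl m)) ⟩
      count (λ β → P (suc m ∷ β)) (avoiders m)
    ∎
    where
    open ≡-Reasoning
    Q : List ℕ → Bool
    Q σ = headIs (suc m) σ ∧ P σ
    head-not-max : ∀ {i α β} → i < m → IsPerm (suc i) α → headIs (suc m) (glue m (suc i) α β) ≡ false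
    head-not-max {α = []}    _   permα with IsPerm.length≡ permα
    ... | ()
    head-not-max {α = _ ∷ _} i<m permα with shift-bounds i<m (IsPerm.inRange permα)
    ... | (_ , a≤m) ∷ _ = ≢⇒≡ᵇ-false λ a≡ → n≮n m (subst (_≤ m) a≡ a≤m)

  count-glued-last : ∀ Q m → count-glued Q m m ≡ count (λ α → Q (α ∷ʳ suc m)) (avoiders m)
  count-glued-last Q m = sum-map-cong-local {xs = avoiders m} (All.tabulate λ {α} _ → single α)
    where
    single : ∀ α → count Q (map (glue m m α) (avoiders (m ∸ m))) ≡ 𝟙 (Q (α ∷ʳ suc m))
    single α rewrite n∸n≡0 m = trans (+-identityʳ _) (cong (λ α′ → 𝟙 (Q (α′ ∷ʳ suc m))) (map-id α))

  count-max-last : ∀ (P : List ℕ → Bool) m →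
                   count (λ σ → lastIs (suc m) σ ∧ P σ) (avoiders (suc m)) ≡ count (λ α → P (α ∷ʳ suc m)) (avoiders m)
  count-max-last P m = begin
      count Q (avoiders (suc m))
    ≡⟨ count-avoiders-suc Q m ⟩
      sum (map (count-glued Q m) (upTo (suc m)))
    ≡⟨ sum-upTo-last (count-glued Q m) m (λ j j<m → count-glued-false Q m j
         (All.tabulate λ {α} _ → All.map (λ permβ → false-∧ _ (last-not-max {α = α} j<m permβ)) (avoiders-isPerm (m ∸ j)))) ⟩
      count-glued Q m m
    ≡⟨ count-glued-last Q m ⟩
      count (λ α → Q (α ∷ʳ suc m)) (avoiders m)
    ≡⟨ count-cong-local {xs = avoiders m} (All.tabulate λ {α} _ → true-∧ _ (trans (lastIs-++-∷ (suc m) α (suc m) []) (≡ᵇ-refl m))) ⟩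
      count (λ α → P (α ∷ʳ suc m)) (avoiders m)
    ∎
    where
    open ≡-Reasoning
    Q : List ℕ → Bool
    Q σ = lastIs (suc m) σ ∧ P σ
    last-not-max : ∀ {j α β} → j < m → IsPerm (m ∸ j) β → lastIs (suc m) (glue m j α β) ≡ false
    last-not-max {j} {β = []}    j<m permβ = ⊥-elim (m>n⇒m∸n≢0 j<m (sym (IsPerm.length≡ permβ)))
    last-not-max {j} {α} {β = b ∷ β} j<m permβ = trans (lastIs-++-∷ (suc m) (shift (m ∸ j) α) (suc m) (b ∷ β))
      (lastIs-< (suc m) (All.map (λ (_ , b≤) → s≤s (≤-trans b≤ (m∸n≤m m j))) (IsPerm.inRange permβ)))

  H-suc : ∀ m → H (suc m) ≡ H⁺ m
  H-suc m = trans (count-max-first (goodFrom false) m) (count-cong-local (All.map (goodFrom-false-max∷ m _) (avoiders-≤ m)))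

  H⁺-suc : ∀ m → H⁺ (suc m) ≡ count (λ β → goodFrom (headIs m β) β) (avoiders m)
  H⁺-suc m = trans (count-max-first (goodFrom true) m) (count-cong-local (All.map (goodFrom-true-max∷ m _) (avoiders-≤ m)))

  L-suc : ∀ m → L (suc m) ≡ L⁺ m
  L-suc m = trans (count-max-last (λ σ → goodBetween false σ false) m)
                  (count-cong-local (All.map (λ {α} α≤m → trans (goodBetween-∷ʳ-max m α false α≤m) (flag-in (lastIs m α) α))
                                             (avoiders-≤ m)))
    where
    flag-in : ∀ b α → goodBetween false α b ∧ (b ∨ false) ≡ b ∧ goodBetween false α true
    flag-in true  α = ∧-identityʳ _
    flag-in false α = ∧-zeroʳ _

  L⁺-suc : ∀ m → L⁺ (suc m) ≡ count (λ α → goodBetween false α (lastIs m α)) (avoiders m)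
  L⁺-suc m = trans (count-max-last (λ σ → goodBetween false σ true) m)
                   (count-cong-local (All.map (λ {α} α≤m → trans (goodBetween-∷ʳ-max m α true α≤m)
                                                            (trans (cong (goodBetween false α (lastIs m α) ∧_) (∨-zeroʳ (lastIs m α))) (∧-identityʳ _)))
                                              (avoiders-≤ m)))

  -- Both sides equal count (h ∧ φ true) + count (not h ∧ φ false) + count (h ∧ φ false).
  count-flag : ∀ (φ : Bool → List ℕ → Bool) (h : List ℕ → Bool) xs →
               count (λ σ → φ (h σ) σ) xs + count (λ σ → h σ ∧ φ false σ) xs ≡ count (λ σ → h σ ∧ φ true σ) xs + count (φ false) xs
  count-flag φ h xs = begin
      count (λ σ → φ (h σ) σ) xs + Y
    ≡⟨ cong (_+ Y) (trans (count-split h (λ σ → φ (h σ) σ) xs) (cong₂ _+_ (count-cong-local {xs = xs} (All.tabulate λ {σ} _ → on-h σ))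
                                                                           (count-cong-local {xs = xs} (All.tabulate λ {σ} _ → off-h σ)))) ⟩
      (X + N) + Y
    ≡⟨ +-assoc X N Y ⟩
      X + (N + Y)
    ≡⟨ cong (X +_) (+-comm N Y) ⟩
      X + (Y + N)
    ≡⟨ cong (X +_) (sym (count-split h (φ false) xs)) ⟩
      X + count (φ false) xs
    ∎
    where
    open ≡-Reasoning
    X Y N : ℕ
    X = count (λ σ → h σ ∧ φ true σ) xs
    Y = count (λ σ → h σ ∧ φ false σ) xs
    N = count (λ σ → not (h σ) ∧ φ false σ) xs
    on-h : ∀ σ → h σ ∧ φ (h σ) σ ≡ h σ ∧ φ true σ
    on-h σ with h σ
    ... | true  = refl
    ... | false = refl
    off-h : ∀ σ → not (h σ) ∧ φ (h σ) σ ≡ not (h σ) ∧ φ false σ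
    off-h σ with h σ
    ... | true  = refl
    ... | false = refl

  H⁺-suc+H : ∀ m → H⁺ (suc m) + H m ≡ H⁺ m + G m
  H⁺-suc+H m = trans (cong (_+ H m) (H⁺-suc m)) (count-flag goodFrom (headIs m) (avoiders m))

  L⁺-suc+L : ∀ m → L⁺ (suc m) + L m ≡ L⁺ m + G m
  L⁺-suc+L m = trans (cong (_+ L m) (L⁺-suc m))
    (trans (count-flag (λ b σ → goodBetween false σ b) (lastIs m) (avoiders m))
           (cong (L⁺ m +_) (sym (count-cong-local {xs = avoiders m} (All.tabulate λ {σ} _ → goodFrom≡goodBetween false σ)))))

  -- L⁺, L and H⁺, H satisfy the same recursions from the same initial values.
  L⁺≡H⁺×L≡H : ∀ m → L⁺ m ≡ H⁺ m × L m ≡ H m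
  L⁺≡H⁺×L≡H zero    = refl , refl
  L⁺≡H⁺×L≡H (suc m) with L⁺≡H⁺×L≡H m
  ... | L⁺≡H⁺ , L≡H = +-cancelʳ-≡ (L m) (L⁺ (suc m)) (H⁺ (suc m)) (begin
        L⁺ (suc m) + L m   ≡⟨ L⁺-suc+L m ⟩
        L⁺ m + G m         ≡⟨ cong (_+ G m) L⁺≡H⁺ ⟩
        H⁺ m + G m         ≡⟨ sym (H⁺-suc+H m) ⟩
        H⁺ (suc m) + H m   ≡⟨ cong (H⁺ (suc m) +_) (sym L≡H) ⟩
        H⁺ (suc m) + L m   ∎)
    , trans (L-suc m) (trans L⁺≡H⁺ (sym (H-suc m)))
    where open ≡-Reasoning

  -- Deleting the maximum m+1 splits a good avoider into a prefix whose last entry m is rescued by m+1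
  -- (counted by L⁺) and an arbitrary good suffix; if the prefix is empty, m+1 needs the suffix to start with m.
  G-suc : ∀ m → G (suc m) ≡ H⁺ m + sum (map (λ j → L⁺ j * G (m ∸ j)) (upTo (suc m)))
  G-suc m = trans (count-avoiders-suc (goodFrom false) m)
    (cong₂ _+_ max-first (sum-map-cong-local {xs = applyUpTo suc m} (All.tabulate split)))
    where
    max-first : count-glued (goodFrom false) m 0 ≡ H⁺ m
    max-first = trans (+-identityʳ _) (trans (count-map _ (glue m 0 []) (avoiders m))
                                             (count-cong-local (All.map (goodFrom-false-max∷ m _) (avoiders-≤ m))))
    glued-good : ∀ {i α β} → i < m → IsPerm (suc i) α → All (_≤ m ∸ suc i) β →
                 goodFrom false (glue m (suc i) α β) ≡ (lastIs (suc i) α ∧ goodBetween false α true) ∧ goodFrom false β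
    glued-good {i} {α} {β} i<m permα β≤ =
      trans (goodFrom-++-max∷ m (shift c α) β shift≢[] (All.map proj₂ (shift-bounds i<m (IsPerm.inRange permα)))
                              (All.map (λ b≤c → ≤-<-trans b≤c c<m) β≤))
            (cong (_∧ goodFrom false β) (cong₂ _∧_ (trans (cong (λ n → lastIs n (shift c α)) (sym (m∸n+n≡m i<m)))
                                                          (lastIs-shift c (suc i) α))
                                                   (goodBetween-shift c false α true)))
      where
      c : ℕ
      c = m ∸ suc i
      c<m : c < m
      c<m = ∸-monoʳ-< {m} {suc i} {0} (s≤s z≤n) i<m
      shift≢[] : shift c α ≢ []
      shift≢[] shift≡[] = 0≢1+n (trans (sym (cong length shift≡[])) (trans (length-map (c +_) α) (IsPerm.length≡ permα)))
    split : ∀ {j} → j ∈ applyUpTo suc m → count-glued (goodFrom false) m j ≡ L⁺ j * G (m ∸ j)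
    split j∈ with ∈-applyUpTo⁻ suc j∈
    ... | i , i<m , refl =
      count-pairs (λ α → lastIs (suc i) α ∧ goodBetween false α true) (goodFrom false) (goodFrom false)
                  (glue m (suc i)) (avoiders (suc i)) (avoiders (m ∸ suc i))
                  (All.map (λ permα → All.map (glued-good i<m permα) (avoiders-≤ (m ∸ suc i))) (avoiders-isPerm (suc i)))


module PowerSeries where

  open import Defs
  open import Algebra.Bundles using (CommutativeRing)
  open import Algebra.Structures using (IsCommutativeRing)
  import Algebra.Solver.Ring
  import Algebra.Solver.Ring.AlmostCommutativeRing as ACR
  open import Data.Nat using (ℕ; zero; suc; _∸_)
  open import Data.Integer using (ℤ; +_; -_; _+_; _*_; _≟_)
  import Data.Integer.Properties as ℤ
  open import Data.Integer.Tactic.RingSolver using (solve-∀)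
  open import Data.List using ([]; _∷_; map; applyUpTo)
  open import Data.Maybe using (Maybe; just; nothing)
  open import Data.Product using (_,_)
  open import Relation.Binary.Structures using (IsEquivalence)
  open import Function using (_∘_)
  open import Relation.Nullary using (yes; no)
  open import Relation.Binary.PropositionalEquality

  tail : FPS → FPS
  tail f n = f (suc n)

  conv : FPS → FPS → FPS
  conv f g zero    = f 0 * g 0
  conv f g (suc n) = f 0 * g (suc n) + conv (tail f) g n

  map-applyUpTo : ∀ (h : ℕ → ℤ) (s : ℕ → ℕ) n → map h (applyUpTo s n) ≡ applyUpTo (λ k → h (s k)) n
  map-applyUpTo h s zero    = refl
  map-applyUpTo h s (suc n) = cong (h (s 0) ∷_) (map-applyUpTo h (λ k → s (suc k)) n)

  sumℤ-applyUpTo≡conv : ∀ f g n → sumℤ (applyUpTo (λ k → f k * g (n ∸ k)) (suc n)) ≡ conv f g n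
  sumℤ-applyUpTo≡conv f g zero    = ℤ.+-identityʳ _
  sumℤ-applyUpTo≡conv f g (suc n) = cong (_+_ (f 0 * g (suc n))) (sumℤ-applyUpTo≡conv (tail f) g n)

  ⊛≈conv : ∀ f g → f ⊛ g ≈ conv f g
  ⊛≈conv f g n = trans (cong sumℤ (map-applyUpTo (λ k → f k * g (n ∸ k)) (λ k → k) (suc n))) (sumℤ-applyUpTo≡conv f g n)

  zeroS oneS : FPS
  zeroS _ = + 0
  oneS    = poly (+ 1 ∷ [])

  negS : FPS → FPS
  negS f n = - f n

  scale : ℤ → FPS → FPS
  scale c f n = c * f n

  conv-cong : ∀ {f f′ g g′} → f ≈ f′ → g ≈ g′ → conv f g ≈ conv f′ g′
  conv-cong f≈ g≈ zero    = cong₂ _*_ (f≈ 0) (g≈ 0)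
  conv-cong f≈ g≈ (suc n) = cong₂ _+_ (cong₂ _*_ (f≈ 0) (g≈ (suc n))) (conv-cong (λ k → f≈ (suc k)) g≈ n)

  conv-zeroˡ : ∀ g → conv zeroS g ≈ zeroS
  conv-zeroˡ g zero    = refl
  conv-zeroˡ g (suc n) = trans (ℤ.+-identityˡ _) (conv-zeroˡ g n)

  conv-distribʳ : ∀ f f′ g → conv (f ⊕ f′) g ≈ conv f g ⊕ conv f′ g
  conv-distribʳ f f′ g zero    = ℤ.*-distribʳ-+ (g 0) (f 0) (f′ 0)
  conv-distribʳ f f′ g (suc n) =
    trans (cong (_+_ ((f 0 + f′ 0) * g (suc n))) (conv-distribʳ (tail f) (tail f′) g n))
          (regroup (f 0) (f′ 0) (g (suc n)) (conv (tail f) g n) (conv (tail f′) g n))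
    where
    regroup : ∀ a b c x y → (a + b) * c + (x + y) ≡ (a * c + x) + (b * c + y)
    regroup = solve-∀

  conv-scaleˡ : ∀ c f g → conv (scale c f) g ≈ scale c (conv f g)
  conv-scaleˡ c f g zero    = ℤ.*-assoc c (f 0) (g 0)
  conv-scaleˡ c f g (suc n) =
    trans (cong (_+_ (c * f 0 * g (suc n))) (conv-scaleˡ c (tail f) g n)) (regroup c (f 0) (g (suc n)) (conv (tail f) g n))
    where
    regroup : ∀ a b d x → a * b * d + a * x ≡ a * (b * d + x)
    regroup = solve-∀

  conv-constˡ : ∀ c g → conv (poly (c ∷ [])) g ≈ scale c g
  conv-constˡ c g zero    = refl
  conv-constˡ c g (suc n) = trans (cong (_+_ (c * g (suc n))) (conv-zeroˡ g n)) (ℤ.+-identityʳ _)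

  conv-sucʳ : ∀ f g n → conv f g (suc n) ≡ f (suc n) * g 0 + conv f (tail g) n
  conv-sucʳ f g zero    = ℤ.+-comm (f 0 * g 1) (f 1 * g 0)
  conv-sucʳ f g (suc n) =
    trans (cong (_+_ (f 0 * g (suc (suc n)))) (conv-sucʳ (tail f) g n))
          (swap (f 0 * g (suc (suc n))) (f (suc (suc n)) * g 0) (conv (tail f) (tail g) n))
    where
    swap : ∀ a b c → a + (b + c) ≡ b + (a + c)
    swap = solve-∀

  conv-comm : ∀ f g → conv f g ≈ conv g f
  conv-comm f g zero    = ℤ.*-comm (f 0) (g 0)
  conv-comm f g (suc n) =
    trans (cong₂ _+_ (ℤ.*-comm (f 0) (g (suc n))) (conv-comm (tail f) g n)) (sym (conv-sucʳ g f n))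

  conv-assoc : ∀ f g h → conv (conv f g) h ≈ conv f (conv g h)
  conv-assoc f g h zero    = ℤ.*-assoc (f 0) (g 0) (h 0)
  conv-assoc f g h (suc n) = begin
      f 0 * g 0 * h (suc n) + conv (tail (conv f g)) h n
    ≡⟨ cong (_+_ (f 0 * g 0 * h (suc n))) (conv-distribʳ (scale (f 0) (tail g)) (conv (tail f) g) h n) ⟩
      f 0 * g 0 * h (suc n) + (conv (scale (f 0) (tail g)) h n + conv (conv (tail f) g) h n)
    ≡⟨ cong₂ (λ u v → f 0 * g 0 * h (suc n) + (u + v)) (conv-scaleˡ (f 0) (tail g) h n) (conv-assoc (tail f) g h n) ⟩
      f 0 * g 0 * h (suc n) + (f 0 * conv (tail g) h n + conv (tail f) (conv g h) n)
    ≡⟨ regroup (f 0) (g 0) (h (suc n)) (conv (tail g) h n) (conv (tail f) (conv g h) n) ⟩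
      f 0 * (g 0 * h (suc n) + conv (tail g) h n) + conv (tail f) (conv g h) n
    ∎
    where
    open ≡-Reasoning
    regroup : ∀ a b c x y → a * b * c + (a * x + y) ≡ a * (b * c + x) + y
    regroup = solve-∀

  ≈-isEquivalence : IsEquivalence _≈_
  ≈-isEquivalence = record
    { refl  = λ _ → refl
    ; sym   = λ f≈g n → sym (f≈g n)
    ; trans = λ f≈g g≈h n → trans (f≈g n) (g≈h n)
    }

  open IsEquivalence ≈-isEquivalence public using () renaming (refl to ≈-refl; sym to ≈-sym; trans to ≈-trans)

  ⊛-cong : ∀ {f f′ g g′} → f ≈ f′ → g ≈ g′ → f ⊛ g ≈ f′ ⊛ g′
  ⊛-cong {f} {f′} {g} {g′} f≈ g≈ = ≈-trans (⊛≈conv f g) (≈-trans (conv-cong f≈ g≈) (≈-sym (⊛≈conv f′ g′)))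

  ⊛-comm : ∀ f g → f ⊛ g ≈ g ⊛ f
  ⊛-comm f g = ≈-trans (⊛≈conv f g) (≈-trans (conv-comm f g) (≈-sym (⊛≈conv g f)))

  ⊛-assoc : ∀ f g h → (f ⊛ g) ⊛ h ≈ f ⊛ (g ⊛ h)
  ⊛-assoc f g h = ≈-trans (⊛≈conv (f ⊛ g) h) (≈-trans (conv-cong (⊛≈conv f g) ≈-refl)
    (≈-trans (conv-assoc f g h) (≈-trans (conv-cong ≈-refl (≈-sym (⊛≈conv g h))) (≈-sym (⊛≈conv f (g ⊛ h))))))

  const-⊛ : ∀ c g → poly (c ∷ []) ⊛ g ≈ scale c g
  const-⊛ c g = ≈-trans (⊛≈conv (poly (c ∷ [])) g) (conv-constˡ c g)

  ⊛-identityˡ : ∀ f → oneS ⊛ f ≈ f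
  ⊛-identityˡ f = ≈-trans (const-⊛ (+ 1) f) (ℤ.*-identityˡ ∘ f)

  ⊛-distribʳ : ∀ f g h → (g ⊕ h) ⊛ f ≈ g ⊛ f ⊕ h ⊛ f
  ⊛-distribʳ f g h = ≈-trans (⊛≈conv (g ⊕ h) f)
    (≈-trans (conv-distribʳ g h f) (λ n → cong₂ _+_ (sym (⊛≈conv g f n)) (sym (⊛≈conv h f n))))

  ⊛-distribˡ : ∀ f g h → f ⊛ (g ⊕ h) ≈ f ⊛ g ⊕ f ⊛ h
  ⊛-distribˡ f g h = ≈-trans (⊛-comm f (g ⊕ h)) (≈-trans (⊛-distribʳ f g h) (λ n → cong₂ _+_ (⊛-comm g f n) (⊛-comm h f n)))

  FPS-isCommutativeRing : IsCommutativeRing _≈_ _⊕_ _⊛_ negS zeroS oneS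
  FPS-isCommutativeRing = record
    { isRing = record
      { +-isAbelianGroup = record
        { isGroup = record
          { isMonoid = record
            { isSemigroup = record
              { isMagma = record { isEquivalence = ≈-isEquivalence ; ∙-cong = λ f≈ g≈ n → cong₂ _+_ (f≈ n) (g≈ n) }
              ; assoc   = λ f g h n → ℤ.+-assoc (f n) (g n) (h n)
              }
            ; identity = (λ f n → ℤ.+-identityˡ (f n)) , (λ f n → ℤ.+-identityʳ (f n))
            }
          ; inverse = (λ f n → ℤ.+-inverseˡ (f n)) , (λ f n → ℤ.+-inverseʳ (f n))
          ; ⁻¹-cong = λ f≈ n → cong -_ (f≈ n)
          }
        ; comm = λ f g n → ℤ.+-comm (f n) (g n)
        }
      ; *-cong     = ⊛-cong
      ; *-assoc    = ⊛-assoc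
      ; *-identity = ⊛-identityˡ , (λ f → ≈-trans (⊛-comm f oneS) (⊛-identityˡ f))
      ; distrib    = ⊛-distribˡ , ⊛-distribʳ
      }
    ; *-comm = ⊛-comm
    }

  FPS-commutativeRing : CommutativeRing _ _
  FPS-commutativeRing = record { isCommutativeRing = FPS-isCommutativeRing }

  const : ℤ → FPS
  const c = poly (c ∷ [])

  const-* : ∀ x y → const (x * y) ≈ const x ⊛ const y
  const-* x y zero    = sym (ℤ.+-identityʳ (x * y))
  const-* x y (suc n) = sym (trans (const-⊛ x (const y) (suc n)) (ℤ.*-zeroʳ x))

  ℤ⟶FPS : CommutativeRing.rawRing ℤ.+-*-commutativeRing ACR.-Raw-AlmostCommutative⟶ ACR.fromCommutativeRing FPS-commutativeRing
  ℤ⟶FPS = record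
    { ⟦_⟧    = const
    ; +-homo = λ x y → λ { zero → refl ; (suc n) → refl }
    ; *-homo = const-*
    ; -‿homo = λ x → λ { zero → refl ; (suc n) → refl }
    ; 0-homo = λ { zero → refl ; (suc n) → refl }
    ; 1-homo = λ { zero → refl ; (suc n) → refl }
    }

  const-≟ : ∀ x y → Maybe (const x ≈ const y)
  const-≟ x y with x ≟ y
  ... | yes refl = just ≈-refl
  ... | no  _    = nothing

  module FPS-Solver = Algebra.Solver.Ring (CommutativeRing.rawRing ℤ.+-*-commutativeRing)
                                          (ACR.fromCommutativeRing FPS-commutativeRing) ℤ⟶FPS const-≟


module SquareRoot where

  open import Defs
  open PowerSeries
  open FPS-Solver using (solve; _:=_; _:+_; _:*_; :-_; con; Polynomial)
  open import Data.Nat using (zero; suc)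
  open import Data.Integer using (ℤ; +_; -_; _+_; _*_)
  import Data.Integer.Properties as ℤ
  open import Data.List using (List; []; _∷_)
  open import Data.Product using (_×_; _,_)
  open import Relation.Binary.PropositionalEquality

  X : FPS
  X = poly (+ 0 ∷ + 1 ∷ [])

  X⊛-suc : ∀ f n → (X ⊛ f) (suc n) ≡ f n
  X⊛-suc f n = trans (⊛≈conv X f (suc n)) (trans (ℤ.+-identityˡ _) (trans (conv-constˡ (+ 1) f n) (ℤ.*-identityˡ (f n))))

  horner : List ℤ → FPS → FPS
  horner []       x = const (+ 0)
  horner (c ∷ cs) x = const c ⊕ x ⊛ horner cs x

  poly≈horner : ∀ cs → poly cs ≈ horner cs X
  poly≈horner []       zero    = refl
  poly≈horner []       (suc n) = refl
  poly≈horner (c ∷ cs) zero    = sym (ℤ.+-identityʳ c)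
  poly≈horner (c ∷ cs) (suc n) = trans (poly≈horner cs n) (sym (trans (ℤ.+-identityˡ _) (X⊛-suc (horner cs X) n)))

  hornerᴾ : List ℤ → Polynomial 3 → Polynomial 3
  hornerᴾ []       x = con (+ 0)
  hornerᴾ (c ∷ cs) x = con c :+ x :* hornerᴾ cs x

  numᴬ denᴬ numᴮ denᴮ disc : List ℤ
  numᴬ = + 1 ∷ - + 1 ∷ + 0 ∷ + 2 ∷ []
  denᴬ = + 0 ∷ + 0 ∷ + 2 ∷ []
  numᴮ = + 1 ∷ + 1 ∷ - + 2 ∷ + 2 ∷ []
  denᴮ = + 2 ∷ - + 2 ∷ + 2 ∷ []
  disc = + 1 ∷ - + 2 ∷ - + 3 ∷ + 4 ∷ - + 4 ∷ []

  Φ Ψ : FPS → FPS → FPS → FPS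
  Φ g r x = oneS ⊕ x ⊛ r ⊕ x ⊛ r ⊛ g
  Ψ g r x = x ⊛ r ⊕ x ⊛ g ⊕ negS (x ⊛ x ⊛ r)

  cofactorΦ cofactorΨᴬ cofactorΨᴮ : FPS → FPS → FPS → FPS
  cofactorΦ  g r x = const (- + 4) ⊛ x ⊛ x ⊛ (oneS ⊕ negS x ⊕ x ⊛ x)
  cofactorΨᴬ g r x = const (- + 4) ⊛ x ⊛ x ⊛ x ⊛ (oneS ⊕ g)
  cofactorΨᴮ g r x = const (- + 4) ⊛ x ⊛ x ⊛ x ⊛ (oneS ⊕ g)
                   ⊕ const (- + 4) ⊛ x ⊛ (oneS ⊕ negS x ⊕ const (- + 2) ⊛ x ⊛ x ⊛ g)
                   ⊕ const (+ 4) ⊛ x ⊛ x ⊛ (r ⊕ negS (Ψ g r x))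

  -- Each square minus the discriminant lies in the ideal generated by g − Φ and r − Ψ.
  square-certificateᴬ : ∀ g r x →
    (horner numᴬ x ⊕ negS (horner denᴬ x ⊛ (g ⊕ x))) ⊛ (horner numᴬ x ⊕ negS (horner denᴬ x ⊛ (g ⊕ x)))
    ≈ horner disc x ⊕ ((g ⊕ negS (Φ g r x)) ⊛ cofactorΦ g r x ⊕ (r ⊕ negS (Ψ g r x)) ⊛ cofactorΨᴬ g r x)
  square-certificateᴬ = solve 3 (λ g r x →
    let u = g :+ :- (con (+ 1) :+ x :* r :+ x :* r :* g)
        v = r :+ :- (x :* r :+ x :* g :+ :- (x :* x :* r))
        s = hornerᴾ numᴬ x :+ :- (hornerᴾ denᴬ x :* (g :+ x))
    in s :* s := hornerᴾ disc x :+ (u :* (con (- + 4) :* x :* x :* (con (+ 1) :+ :- x :+ x :* x))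
                                   :+ v :* (con (- + 4) :* x :* x :* x :* (con (+ 1) :+ g)))) ≈-refl

  square-certificateᴮ : ∀ g r x →
    (horner numᴮ x ⊕ negS (horner denᴮ x ⊛ (x ⊕ x ⊛ r))) ⊛ (horner numᴮ x ⊕ negS (horner denᴮ x ⊛ (x ⊕ x ⊛ r)))
    ≈ horner disc x ⊕ ((g ⊕ negS (Φ g r x)) ⊛ cofactorΦ g r x ⊕ (r ⊕ negS (Ψ g r x)) ⊛ cofactorΨᴮ g r x)
  square-certificateᴮ = solve 3 (λ g r x →
    let u = g :+ :- (con (+ 1) :+ x :* r :+ x :* r :* g)
        v = r :+ :- (x :* r :+ x :* g :+ :- (x :* x :* r))
        s = hornerᴾ numᴮ x :+ :- (hornerᴾ denᴮ x :* (x :+ x :* r))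
    in s :* s := hornerᴾ disc x :+ (u :* (con (- + 4) :* x :* x :* (con (+ 1) :+ :- x :+ x :* x))
                                   :+ v :* (con (- + 4) :* x :* x :* x :* (con (+ 1) :+ g)
                                            :+ con (- + 4) :* x :* (con (+ 1) :+ :- x :+ con (- + 2) :* x :* x :* g)
                                            :+ con (+ 4) :* x :* x :* v))) ≈-refl

  vanishing-cofactors : ∀ {s u v} c d → u ≈ zeroS → v ≈ zeroS → s ⊕ (u ⊛ c ⊕ v ⊛ d) ≈ s
  vanishing-cofactors {s} {u} {v} c d u≈0 v≈0 n =
    trans (cong₂ (λ x y → s n + (x + y)) (vanish u≈0 c n) (vanish v≈0 d n)) (ℤ.+-identityʳ (s n))
    where
    vanish : ∀ {w} → w ≈ zeroS → ∀ e → w ⊛ e ≈ zeroS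
    vanish {w} w≈0 e = ≈-trans (⊛-cong w≈0 ≈-refl) (≈-trans (⊛≈conv zeroS e) (conv-zeroˡ e))

  ≈⇒⊖≈0 : ∀ {f g} → f ≈ g → f ⊕ negS g ≈ zeroS
  ≈⇒⊖≈0 {f} {g} f≈g n = trans (cong (_+ - g n) (f≈g n)) (ℤ.+-inverseʳ (g n))

  isSqrt-of-functional-equations :
    ∀ {A B g r} → A ≈ g ⊕ X → B ≈ X ⊕ X ⊛ r → g ≈ Φ g r X → r ≈ Ψ g r X →
    IsSqrt (poly numᴬ ⊖ poly denᴬ ⊛ A) Disc × IsSqrt (poly numᴮ ⊖ poly denᴮ ⊛ B) Disc
  isSqrt-of-functional-equations {A} {B} {g} {r} A≈ B≈ g≈Φ r≈Ψ =
      (cong (λ a₀ → + 1 + - (+ 0 * a₀ + + 0)) (A≈ 0) , square≈disc numᴬ denᴬ (cofactorΨᴬ g r X) A≈ (square-certificateᴬ g r X))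
    , (cong (λ b₀ → + 1 + - (+ 2 * b₀ + + 0)) (B≈ 0) , square≈disc numᴮ denᴮ (cofactorΨᴮ g r X) B≈ (square-certificateᴮ g r X))
    where
    square≈disc : ∀ num den cofactorΨ {F F′} → F ≈ F′ →
                  (horner num X ⊕ negS (horner den X ⊛ F′)) ⊛ (horner num X ⊕ negS (horner den X ⊛ F′))
                    ≈ horner disc X ⊕ ((g ⊕ negS (Φ g r X)) ⊛ cofactorΦ g r X ⊕ (r ⊕ negS (Ψ g r X)) ⊛ cofactorΨ) →
                  (poly num ⊖ poly den ⊛ F) ⊛ (poly num ⊖ poly den ⊛ F) ≈ Disc
    square≈disc num den cofactorΨ {F} {F′} F≈ certificate =
      ≈-trans (⊛-cong S≈ S≈)
        (≈-trans certificate (≈-trans (vanishing-cofactors _ _ (≈⇒⊖≈0 g≈Φ) (≈⇒⊖≈0 r≈Ψ)) (≈-sym (poly≈horner disc))))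
      where
      S≈ : poly num ⊖ poly den ⊛ F ≈ horner num X ⊕ negS (horner den X ⊛ F′)
      S≈ n = cong₂ (λ s t → s + - t) (poly≈horner num n) (⊛-cong (poly≈horner den) F≈ n)


module GeneratingFunctions where

  open import Defs
  open Counting
  open Avoiders
  open Permutations using (IsPerm)
  open Recurrences
  open PowerSeries
  open SquareRoot
  open import Data.Bool using (false; _∧_)
  open import Data.Bool.Properties using (∧-comm)
  open import Data.Nat as ℕ using (ℕ; zero; suc; _∸_)
  open import Data.Nat.ListAction using (sum)
  open import Data.Integer using (ℤ; +_; -_; _+_; _*_)
  import Data.Integer.Properties as ℤ
  open import Data.Integer.Tactic.RingSolver using (solve-∀)
  open import Data.List using ([]; _∷_; map; upTo; length)
  open import Data.List.Relation.Unary.All as All using (All; []; _∷_)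
  open import Data.Product using (_×_; proj₁)
  open import Relation.Binary.PropositionalEquality

  -- good differs from goodFrom false only on words of length ≤ 1.
  a≡G : ∀ n → a (suc (suc n)) ≡ G (suc (suc n))
  a≡G n = trans (length-filter-perms (suc (suc n)) good)
                (count-cong-local (All.map (λ {σ} perm → good≡ σ (IsPerm.length≡ perm)) (avoiders-isPerm (suc (suc n)))))
    where
    good≡ : ∀ σ → length σ ≡ suc (suc n) → good σ ≡ goodFrom false σ
    good≡ (_ ∷ _ ∷ _) _ = refl

  b≡H⁺ : ∀ n → b (suc (suc n)) ≡ H⁺ (suc n)
  b≡H⁺ n = trans (length-filter-perms (suc (suc n)) (λ σ → good σ ∧ headIs (suc (suc n)) σ))
    (trans (count-cong-local (All.map (λ {σ} perm → good∧head≡ σ (IsPerm.length≡ perm)) (avoiders-isPerm (suc (suc n)))))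
           (H-suc (suc n)))
    where
    good∧head≡ : ∀ σ → length σ ≡ suc (suc n) → good σ ∧ headIs (suc (suc n)) σ ≡ headIs (suc (suc n)) σ ∧ goodFrom false σ
    good∧head≡ σ@(_ ∷ _ ∷ _) _ = ∧-comm (goodFrom false σ) _

  gf-⊛ : ∀ f g n → (gf f ⊛ gf g) n ≡ + sum (map (λ k → f k ℕ.* g (n ∸ k)) (upTo (suc n)))
  gf-⊛ f g n = go (upTo (suc n))
    where
    go : ∀ ks → sumℤ (map (λ k → + f k * + g (n ∸ k)) ks) ≡ + sum (map (λ k → f k ℕ.* g (n ∸ k)) ks)
    go []       = refl
    go (k ∷ ks) = trans (cong₂ _+_ (sym (ℤ.pos-* (f k) (g (n ∸ k)))) (go ks)) (sym (ℤ.pos-+ (f k ℕ.* g (n ∸ k)) _))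

  gf-a : gf a ≈ gf G ⊕ X
  gf-a zero          = refl
  gf-a (suc zero)    = refl
  gf-a (suc (suc n)) = trans (cong +_ (a≡G n)) (sym (ℤ.+-identityʳ _))

  gf-b : gf b ≈ X ⊕ X ⊛ gf H⁺
  gf-b zero          = refl
  gf-b (suc zero)    = sym (cong (_+_ (+ 1)) (X⊛-suc (gf H⁺) 0))
  gf-b (suc (suc n)) = trans (cong +_ (b≡H⁺ n)) (sym (trans (ℤ.+-identityˡ _) (X⊛-suc (gf H⁺) (suc n))))

  G-functional-equation : gf G ≈ Φ (gf G) (gf H⁺) X
  G-functional-equation zero    = refl
  G-functional-equation (suc m) = sym (begin
      + 0 + (X ⊛ gf H⁺) (suc m) + ((X ⊛ gf H⁺) ⊛ gf G) (suc m)
    ≡⟨ cong₂ (λ u v → + 0 + u + v) (X⊛-suc (gf H⁺) m) (trans (⊛-assoc X (gf H⁺) (gf G) (suc m)) (X⊛-suc (gf H⁺ ⊛ gf G) m)) ⟩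
      + 0 + + H⁺ m + (gf H⁺ ⊛ gf G) m
    ≡⟨ cong₂ _+_ (ℤ.+-identityˡ (+ H⁺ m)) (gf-⊛ H⁺ G m) ⟩
      + H⁺ m + + sum (map (λ j → H⁺ j ℕ.* G (m ∸ j)) (upTo (suc m)))
    ≡⟨ sym (ℤ.pos-+ (H⁺ m) _) ⟩
      + (H⁺ m ℕ.+ sum (map (λ j → H⁺ j ℕ.* G (m ∸ j)) (upTo (suc m))))
    ≡⟨ cong (λ s → + (H⁺ m ℕ.+ s)) (sum-map-cong-local {xs = upTo (suc m)}
         (All.tabulate λ {j} _ → cong (ℕ._* G (m ∸ j)) (sym (proj₁ (L⁺≡H⁺×L≡H j))))) ⟩
      + (H⁺ m ℕ.+ sum (map (λ j → L⁺ j ℕ.* G (m ∸ j)) (upTo (suc m))))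
    ≡⟨ cong +_ (sym (G-suc m)) ⟩
      + G (suc m)
    ∎)
    where open ≡-Reasoning

  H⁺-functional-equation : gf H⁺ ≈ Ψ (gf G) (gf H⁺) X
  H⁺-functional-equation zero    = refl
  H⁺-functional-equation (suc m) = sym (begin
      (X ⊛ gf H⁺) (suc m) + (X ⊛ gf G) (suc m) + - (X ⊛ X ⊛ gf H⁺) (suc m)
    ≡⟨ cong₂ (λ u v → u + v + - (X ⊛ X ⊛ gf H⁺) (suc m)) (X⊛-suc (gf H⁺) m) (X⊛-suc (gf G) m) ⟩
      + H⁺ m + + G m + - (X ⊛ X ⊛ gf H⁺) (suc m)
    ≡⟨ cong (λ t → + H⁺ m + + G m + - t) (X²⊛H⁺ m) ⟩
      + H⁺ m + + G m + - + H m
    ≡⟨ cong (λ t → t + - + H m) (trans (sym (ℤ.pos-+ (H⁺ m) (G m))) (cong +_ (sym (H⁺-suc+H m)))) ⟩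
      + (H⁺ (suc m) ℕ.+ H m) + - + H m
    ≡⟨ cong (λ t → t + - + H m) (ℤ.pos-+ (H⁺ (suc m)) (H m)) ⟩
      + H⁺ (suc m) + + H m + - + H m
    ≡⟨ cancel (+ H⁺ (suc m)) (+ H m) ⟩
      + H⁺ (suc m)
    ∎)
    where
    open ≡-Reasoning
    cancel : ∀ x y → x + y + - y ≡ x
    cancel = solve-∀
    X²⊛H⁺ : ∀ m → (X ⊛ X ⊛ gf H⁺) (suc m) ≡ + H m
    X²⊛H⁺ m = trans (⊛-assoc X X (gf H⁺) (suc m)) (trans (X⊛-suc (X ⊛ gf H⁺) m) (X⊛H⁺ m))
      where
      X⊛H⁺ : ∀ m → (X ⊛ gf H⁺) m ≡ + H m
      X⊛H⁺ zero    = refl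
      X⊛H⁺ (suc k) = trans (X⊛-suc (gf H⁺) k) (cong +_ (sym (H-suc k)))


open import Defs
open import Data.Integer using (+_; -_)
open import Data.List using ([]; _∷_)
open import Data.Product using (_×_)
open SquareRoot using (isSqrt-of-functional-equations)
open GeneratingFunctions using (gf-a; gf-b; G-functional-equation; H⁺-functional-equation)

theorem7 : IsSqrt (poly (+ 1 ∷ - + 1 ∷ + 0 ∷ + 2 ∷ []) ⊖ poly (+ 0 ∷ + 0 ∷ + 2 ∷ []) ⊛ gf a) Disc
         × IsSqrt (poly (+ 1 ∷ + 1 ∷ - + 2 ∷ + 2 ∷ []) ⊖ poly (+ 2 ∷ - + 2 ∷ + 2 ∷ []) ⊛ gf b) Disc
theorem7 = isSqrt-of-functional-equations gf-a gf-b G-functional-equation H⁺-functional-equation
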